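{- $\gamma^{L\text{ - }ID}(\mathcal{H})=\frac{3}{8}$.
   Context: The hexagonal grid $\mathcal{H}$ has vertex set $\mathbb{Z}^2$, with $\mathbf{u}=(i,j)$ and $\mathbf{v}$ adjacent iff $\mathbf{u}-\mathbf{v}\in\{(\pm1,0),(0,(-1)^{i+j+1})\}$. For a vertex $u$, $N[u]$ is its closed neighbourhood; for a code (nonempty vertex subset) $C$, $I_C(u)=N[u]\cap C$. $C$ is a covering code if $I_C(u)\neq\emptyset$ for all $u$, and a local identifying code if it is covering and $I_C(u)\neq I_C(v)$ for all adjacent $u,v$. The density of $C\subseteq\mathbb{Z}^2$ is $D(C)=\limsup_{n\to\infty}\frac{|C\cap Q_n|}{|Q_n|}$ with $Q_n=\{(i,j)\in\mathbb{Z}^2: |i|\leq n,|j|\leq n\}$. $\gamma^{L\text{ - }ID}(\mathcal{H})$ is the smallest density of a local identifying code in $\mathcal{H}$. -}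

module Defs where

open import Data.Bool using (Bool; true; false; if_then_else_)
open import Data.Nat as ℕ using (ℕ; zero; suc; _%_)
open import Data.Integer as ℤ using (ℤ; +_; -[1+_]; ∣_∣)
open import Data.Rational as ℚ using (ℚ; Positive)
open import Data.List using (List; map; concatMap; upTo)
open import Data.Nat.ListAction using (sum)
open import Data.Product using (Σ; ∃; _×_; _,_)
open import Data.Sum using (_⊎_)
open import Relation.Binary.PropositionalEquality using (_≡_)
open import Relation.Nullary using (¬_)
open import Function.Bundles using (_⇔_)

-- Vertices of the hexagonal grid: ℤ².
Vertex : Set
Vertex = ℤ × ℤ

neg1pow : ℤ → ℤ
neg1pow k with ∣ k ∣ % 2
... | zero  = + 1
... | suc _ = -[1+ 0 ]

Adj : Vertex → Vertex → Set
Adj (i , j) (k , l) =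
    ((i ℤ.- k ≡ + 1) × (j ℤ.- l ≡ + 0))
  ⊎ ((i ℤ.- k ≡ -[1+ 0 ]) × (j ℤ.- l ≡ + 0))
  ⊎ ((i ℤ.- k ≡ + 0) × (j ℤ.- l ≡ neg1pow (i ℤ.+ j ℤ.+ + 1)))

InN : Vertex → Vertex → Set
InN u w = (w ≡ u) ⊎ Adj u w

Code : Set
Code = Vertex → Bool

InI : Code → Vertex → Vertex → Set
InI C u w = InN u w × (C w ≡ true)

Nonempty : Code → Set
Nonempty C = ∃ λ w → C w ≡ true

Covering : Code → Set
Covering C = ∀ u → ∃ λ w → InI C u w

LocalIdCode : Code → Set
LocalIdCode C =
  Nonempty C × Covering C ×
  (∀ u v → Adj u v → ¬ (∀ w → (InI C u w ⇔ InI C v w)))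

range : ℕ → List ℤ
range n = map (λ k → + k ℤ.- + n) (upTo (suc (2 ℕ.* n)))

box : ℕ → List Vertex
box n = concatMap (λ i → map (λ j → (i , j)) (range n)) (range n)

countIn : Code → ℕ → ℕ
countIn C n = sum (map (λ p → if C p then 1 else 0) (box n))

-- |Q_n| = (2n+1)² = suc (4n² + 4n)
sizeQ : ℕ → ℕ
sizeQ n = suc (4 ℕ.* n ℕ.* n ℕ.+ 4 ℕ.* n)

ratio : Code → ℕ → ℚ
ratio C n = (+ countIn C n) ℚ./ sizeQ n

LimsupLE : (ℕ → ℚ) → ℚ → Set
LimsupLE f q = ∀ (ε : ℚ) → Positive ε → ∃ λ N → ∀ n → N ℕ.≤ n → f n ℚ.≤ q ℚ.+ ε

LimsupGE : (ℕ → ℚ) → ℚ → Set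
LimsupGE f q = ∀ (ε : ℚ) → Positive ε → ∀ N → ∃ λ n → N ℕ.≤ n × (q ℚ.- ε ℚ.≤ f n)

HasDensity : Code → ℚ → Set
HasDensity C q = LimsupLE (ratio C) q × LimsupGE (ratio C) q

DensityAtLeast : Code → ℚ → Set
DensityAtLeast C q = LimsupGE (ratio C) q

{-# OPTIONS --safe #-}
-- Lower bound by discharging. Every codeword sends charge to the vertices of its closed
-- neighbourhood: a vertex covered by k codewords receives 12/k from each of them, except that a
-- codeword whose only code neighbour x leaves its two other neighbours covered by it alone receives
-- 4 from itself and 8 from x. So every vertex receives exactly 12, while local identification (some
-- codeword lies in N[u] △ N[v] for every edge uv) bounds what a codeword sends by 32. Summing over
-- the boxes Q n gives 12 |Q n| ≤ 32 |C ∩ Q (n + 1)|, hence density at least 3/8.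
-- Upper bound: the code of the vertices (i , j) with i + 4 j ≡ 0, 1 or 2 mod 8 is locally
-- identifying, and every 8 horizontally consecutive vertices contain exactly 3 of its codewords.
module Submission where

open import Defs
open import Data.Bool using (Bool; true; false; if_then_else_; _∨_; _∧_)
open import Data.Bool.Properties using (T-≡)
open import Data.Nat as ℕ using (ℕ; zero; suc; _%_; _≡ᵇ_; _≤_; z≤n; s≤s)
import Data.Nat.Properties as ℕP
open import Data.Integer as ℤ using (ℤ; +_; -[1+_]; +[1+_]; ∣_∣; _+_; _-_; -_)
import Data.Integer.Properties as ℤP
open import Data.Integer.Tactic.RingSolver using (solve-∀)
import Data.Nat.Tactic.RingSolver as ℕSolver
open import Data.List using (List; []; _∷_; _++_; map; concatMap; applyUpTo)
open import Data.List.Properties using (map-++; map-∘; map-cong)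
open import Data.Nat.ListAction using (sum)
open import Data.Nat.ListAction.Properties using (sum-++)
open import Data.Rational as ℚ using (mkℚ; _/_)
import Data.Rational.Properties as QP
open import Data.Rational.Unnormalised as ℚᵘ using (mkℚᵘ)
import Data.Rational.Unnormalised.Properties as UP
open import Data.Product using (Σ; ∃; ∃₂; _×_; _,_; proj₁; proj₂)
open import Data.Sum using (_⊎_; inj₁; inj₂)
open import Data.Empty using (⊥-elim)
open import Function.Base using (_∘_)
open import Function.Bundles using (_⇔_; mk⇔; Equivalence)
open import Relation.Nullary using (¬_)
open import Relation.Binary.PropositionalEquality

private
  signOf : ℕ → ℤ
  signOf zero    = + 1
  signOf (suc _) = -[1+ 0 ]

  neg1pow≡signOf : ∀ k → neg1pow k ≡ signOf (∣ k ∣ % 2)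
  neg1pow≡signOf k with ∣ k ∣ % 2
  ... | zero  = refl
  ... | suc _ = refl

  signOf-suc : ∀ n → signOf (suc n % 2) ≡ - signOf (n % 2)
  signOf-suc zero          = refl
  signOf-suc (suc zero)    = refl
  signOf-suc (suc (suc n)) = signOf-suc n

neg1pow-suc : ∀ k → neg1pow (k + + 1) ≡ - neg1pow k
neg1pow-suc (+ n) = begin
  neg1pow (+ (n ℕ.+ 1))     ≡⟨ neg1pow≡signOf (+ (n ℕ.+ 1)) ⟩
  signOf ((n ℕ.+ 1) % 2)    ≡⟨ cong (λ m → signOf (m % 2)) (ℕP.+-comm n 1) ⟩
  signOf (suc n % 2)        ≡⟨ signOf-suc n ⟩
  - signOf (n % 2)          ≡⟨ cong -_ (neg1pow≡signOf (+ n)) ⟨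
  - neg1pow (+ n)           ∎
  where open ≡-Reasoning
neg1pow-suc -[1+ zero ]  = refl
neg1pow-suc -[1+ suc n ] = begin
  neg1pow -[1+ n ]          ≡⟨ neg1pow≡signOf -[1+ n ] ⟩
  signOf (suc n % 2)        ≡⟨ signOf-suc n ⟩
  - signOf (n % 2)          ≡⟨ cong -_ (neg1pow≡signOf -[1+ suc n ]) ⟨
  - neg1pow -[1+ suc n ]    ∎
  where open ≡-Reasoning

neg1pow-pred : ∀ k → neg1pow (k - + 1) ≡ - neg1pow k
neg1pow-pred k = begin
  neg1pow (k - + 1)                 ≡⟨ ℤP.neg-involutive _ ⟨
  - - neg1pow (k - + 1)             ≡⟨ cong -_ (neg1pow-suc (k - + 1)) ⟨
  - neg1pow (k - + 1 + + 1)         ≡⟨ cong (-_ ∘ neg1pow) (cancel k) ⟩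
  - neg1pow k                       ∎
  where
  open ≡-Reasoning
  cancel : ∀ k → k - + 1 + + 1 ≡ k
  cancel = solve-∀

neg1pow≡±1 : ∀ k → neg1pow k ≡ + 1 ⊎ neg1pow k ≡ -[1+ 0 ]
neg1pow≡±1 k with ∣ k ∣ % 2
... | zero  = inj₁ refl
... | suc _ = inj₂ refl

neg1pow-minus-itself : ∀ k → neg1pow (k - neg1pow k) ≡ - neg1pow k
neg1pow-minus-itself k with neg1pow≡±1 k
... | inj₁ s≡1  = trans (cong (λ s → neg1pow (k - s)) s≡1) (neg1pow-pred k)
... | inj₂ s≡-1 = trans (cong (λ s → neg1pow (k - s)) s≡-1) (neg1pow-suc k)

-- The hexagonal grid

data Dir : Set where
  east west twist : Dir

orientation : Vertex → ℤ
orientation (i , j) = neg1pow (i + j + + 1)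

step : Dir → Vertex → Vertex
step east  (i , j) = (i + + 1 , j)
step west  (i , j) = (i - + 1 , j)
step twist (i , j) = (i , j - orientation (i , j))

opposite : Dir → Dir
opposite east  = west
opposite west  = east
opposite twist = twist

next : Dir → Dir
next east  = west
next west  = twist
next twist = east

orientation-step : ∀ d u → orientation (step d u) ≡ - orientation u
orientation-step east (i , j) =
  trans (cong neg1pow (shuffle i j)) (neg1pow-suc (i + j + + 1))
  where
  shuffle : ∀ i j → i + + 1 + j + + 1 ≡ i + j + + 1 + + 1
  shuffle = solve-∀
orientation-step west (i , j) =
  trans (cong neg1pow (shuffle i j)) (neg1pow-pred (i + j + + 1))
  where
  shuffle : ∀ i j → i - + 1 + j + + 1 ≡ i + j + + 1 - + 1
  shuffle = solve-∀
orientation-step twist (i , j) =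
  trans (cong neg1pow (shuffle i j (orientation (i , j)))) (neg1pow-minus-itself (i + j + + 1))
  where
  shuffle : ∀ i j s → i + (j - s) + + 1 ≡ i + j + + 1 - s
  shuffle = solve-∀

step-opposite : ∀ d u → step (opposite d) (step d u) ≡ u
step-opposite east (i , j) = cong (_, j) (cancel i)
  where
  cancel : ∀ i → i + + 1 - + 1 ≡ i
  cancel = solve-∀
step-opposite west (i , j) = cong (_, j) (cancel i)
  where
  cancel : ∀ i → i - + 1 + + 1 ≡ i
  cancel = solve-∀
step-opposite twist (i , j) =
  cong (i ,_) (trans (cong (λ t → j - s - t) (orientation-step twist (i , j))) (cancel j s))
  where
  s = orientation (i , j)
  cancel : ∀ j s → j - s - - s ≡ j
  cancel = solve-∀

adj-step : ∀ d u → Adj u (step d u)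
adj-step east (i , j) = inj₂ (inj₁ (eq i , ℤP.+-inverseʳ j))
  where
  eq : ∀ i → i - (i + + 1) ≡ -[1+ 0 ]
  eq = solve-∀
adj-step west (i , j) = inj₁ (eq i , ℤP.+-inverseʳ j)
  where
  eq : ∀ i → i - (i - + 1) ≡ + 1
  eq = solve-∀
adj-step twist (i , j) = inj₂ (inj₂ (ℤP.+-inverseʳ i , eq j (orientation (i , j))))
  where
  eq : ∀ j s → j - (j - s) ≡ s
  eq = solve-∀

adj-step⁻¹ : ∀ d u → Adj (step d u) u
adj-step⁻¹ d u = subst (Adj (step d u)) (step-opposite d u) (adj-step (opposite d) (step d u))

private
  solve-difference : ∀ i k {δ} → i - k ≡ δ → k ≡ i - δ
  solve-difference i k refl = back i k
    where
    back : ∀ i k → k ≡ i - (i - k)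
    back = solve-∀

  same-coordinate : ∀ j l → j - l ≡ + 0 → l ≡ j
  same-coordinate j l eq = trans (solve-difference j l eq) (ℤP.+-identityʳ j)

adj⇒step : ∀ {u v} → Adj u v → ∃ λ d → v ≡ step d u
adj⇒step {i , j} {k , l} (inj₁ (i-k≡1 , j-l≡0)) =
  west , cong₂ _,_ (solve-difference i k i-k≡1) (same-coordinate j l j-l≡0)
adj⇒step {i , j} {k , l} (inj₂ (inj₁ (i-k≡-1 , j-l≡0))) =
  east , cong₂ _,_ (solve-difference i k i-k≡-1) (same-coordinate j l j-l≡0)
adj⇒step {i , j} {k , l} (inj₂ (inj₂ (i-k≡0 , j-l≡s))) =
  twist , cong₂ _,_ (same-coordinate i k i-k≡0) (solve-difference j l j-l≡s)

InN⇒step : ∀ {u w} → InN u w → w ≡ u ⊎ ∃ λ d → w ≡ step d u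
InN⇒step (inj₁ w≡u) = inj₁ w≡u
InN⇒step (inj₂ adj) = inj₂ (adj⇒step adj)

dir-cases : ∀ d e → e ≡ d ⊎ e ≡ next d ⊎ e ≡ next (next d)
dir-cases east  east  = inj₁ refl
dir-cases east  west  = inj₂ (inj₁ refl)
dir-cases east  twist = inj₂ (inj₂ refl)
dir-cases west  east  = inj₂ (inj₂ refl)
dir-cases west  west  = inj₁ refl
dir-cases west  twist = inj₂ (inj₁ refl)
dir-cases twist east  = inj₂ (inj₁ refl)
dir-cases twist west  = inj₂ (inj₂ refl)
dir-cases twist twist = inj₁ refl

next≢ : ∀ d → next d ≢ d
next≢ east  ()
next≢ west  ()
next≢ twist ()

next²≢ : ∀ d → next (next d) ≢ d
next²≢ east  ()
next²≢ west  ()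
next²≢ twist ()

private
  horizontal : Dir → ℤ
  horizontal east  = + 1
  horizontal west  = -[1+ 0 ]
  horizontal twist = + 0

  horizontal-step : ∀ d i j → proj₁ (step d (i , j)) - i ≡ horizontal d
  horizontal-step east  i j = eq i
    where
    eq : ∀ i → i + + 1 - i ≡ + 1
    eq = solve-∀
  horizontal-step west  i j = eq i
    where
    eq : ∀ i → i - + 1 - i ≡ -[1+ 0 ]
    eq = solve-∀
  horizontal-step twist i j = ℤP.+-inverseʳ i

  horizontal-injective : ∀ {d e} → horizontal d ≡ horizontal e → d ≡ e
  horizontal-injective {east}  {east}  _ = refl
  horizontal-injective {west}  {west}  _ = refl
  horizontal-injective {twist} {twist} _ = refl

step-injective : ∀ {d e} u → step d u ≡ step e u → d ≡ e
step-injective {d} {e} (i , j) eq = horizontal-injective (begin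
  horizontal d                 ≡⟨ horizontal-step d i j ⟨
  proj₁ (step d (i , j)) - i   ≡⟨ cong (λ v → proj₁ v - i) eq ⟩
  proj₁ (step e (i , j)) - i   ≡⟨ horizontal-step e i j ⟩
  horizontal e                 ∎)
  where open ≡-Reasoning

-- The grid is bipartite by orientation, so two neighbours of a vertex are never adjacent.
step-∉-N[step] : ∀ {d e} u → e ≢ d → ¬ InN (step d u) (step e u)
step-∉-N[step] {d} {e} u e≢d n with InN⇒step n
... | inj₁ eq = e≢d (step-injective u eq)
... | inj₂ (f , eq) = orientation-≢-neg (begin
  orientation u                   ≡⟨ ℤP.neg-involutive _ ⟨
  - - orientation u               ≡⟨ cong -_ (orientation-step d u) ⟨
  - orientation (step d u)        ≡⟨ orientation-step f (step d u) ⟨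
  orientation (step f (step d u)) ≡⟨ cong orientation eq ⟨
  orientation (step e u)          ≡⟨ orientation-step e u ⟩
  - orientation u                 ∎)
  where
  open ≡-Reasoning
  orientation-≢-neg : orientation u ≢ - orientation u
  orientation-≢-neg with neg1pow≡±1 (proj₁ u + proj₂ u + + 1)
  ... | inj₁ o≡1  rewrite o≡1  = λ ()
  ... | inj₂ o≡-1 rewrite o≡-1 = λ ()

-- Local identification as a condition on symmetric differences

Distinguishes : Code → Vertex → Vertex → Set
Distinguishes C u v = ¬ (∀ w → InI C u w ⇔ InI C v w)

-- N[u] △ N[step d u] consists of the two other neighbours of u and the two other neighbours of step d u.
symDiffHasCode : Code → Dir → Vertex → Bool
symDiffHasCode C d u =
  C (step (next d) u) ∨ C (step (next (next d)) u) ∨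
  C (step (next d′) v) ∨ C (step (next (next d′)) v)
  where
  v  = step d u
  d′ = opposite d

private
  true≢false : ∀ {b} → b ≡ true → b ≢ false
  true≢false refl ()

  ∨-true : ∀ x {y} → x ∨ y ≡ true → x ≡ true ⊎ y ≡ true
  ∨-true true  _ = inj₁ refl
  ∨-true false p = inj₂ p

  ∧-true : ∀ x {y} → x ∧ y ≡ true → x ≡ true × y ≡ true
  ∧-true true p = refl , p

  ∨-false : ∀ x {y} → x ∨ y ≡ false → x ≡ false × y ≡ false
  ∨-false false p = refl , p

  true-or-false : ∀ b → b ≡ true ⊎ b ≡ false
  true-or-false true  = inj₁ refl
  true-or-false false = inj₂ refl

module _ (C : Code) (d : Dir) (u : Vertex) where
  private
    v  = step d u
    d′ = opposite d

  -- Outside the symmetric difference N[u] and N[v] agree, so only its codewords can separate.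
  symDiffHasCode-false⇒same : symDiffHasCode C d u ≡ false → ∀ w → InI C u w ⇔ InI C v w
  symDiffHasCode-false⇒same noCode w = mk⇔ toV toU
    where
    u₁ = ∨-false (C (step (next d) u)) noCode
    u₂ = ∨-false (C (step (next (next d)) u)) (proj₂ u₁)
    v₁ = ∨-false (C (step (next d′) v)) (proj₂ u₂)

    toV : InI C u w → InI C v w
    toV (n , w∈C) with InN⇒step n
    ... | inj₁ refl = inj₂ (adj-step⁻¹ d u) , w∈C
    ... | inj₂ (e , refl) with dir-cases d e
    ...   | inj₁ refl              = inj₁ refl , w∈C
    ...   | inj₂ (inj₁ refl)       = ⊥-elim (true≢false w∈C (proj₁ u₁))
    ...   | inj₂ (inj₂ refl)       = ⊥-elim (true≢false w∈C (proj₁ u₂))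

    toU : InI C v w → InI C u w
    toU (n , w∈C) with InN⇒step n
    ... | inj₁ refl = inj₂ (adj-step d u) , w∈C
    ... | inj₂ (e , refl) with dir-cases d′ e
    ...   | inj₁ refl              = inj₁ (step-opposite d u) , w∈C
    ...   | inj₂ (inj₁ refl)       = ⊥-elim (true≢false w∈C (proj₁ v₁))
    ...   | inj₂ (inj₂ refl)       = ⊥-elim (true≢false w∈C (proj₂ v₁))

  distinguishes⇒symDiffHasCode : Distinguishes C u v → symDiffHasCode C d u ≡ true
  distinguishes⇒symDiffHasCode distinct with symDiffHasCode C d u in eq
  ... | true  = refl
  ... | false = ⊥-elim (distinct (symDiffHasCode-false⇒same eq))

  private
    Same = ∀ w → InI C u w ⇔ InI C v w

    codeOnlyNear-u : Same → ∀ {e} → e ≢ d → C (step e u) ≢ true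
    codeOnlyNear-u same {e} e≢d c =
      step-∉-N[step] u e≢d (proj₁ (Equivalence.to (same (step e u)) (inj₂ (adj-step e u) , c)))

    codeOnlyNear-v : Same → ∀ {e} → e ≢ d′ → C (step e v) ≢ true
    codeOnlyNear-v same {e} e≢d′ c =
      step-∉-N[step] v e≢d′ (subst (λ x → InN x (step e v)) (sym (step-opposite d u))
        (proj₁ (Equivalence.from (same (step e v)) (inj₂ (adj-step e v) , c))))

  symDiffHasCode⇒distinguishes : symDiffHasCode C d u ≡ true → Distinguishes C u v
  symDiffHasCode⇒distinguishes hasCode same
    with ∨-true (C (step (next d) u)) hasCode
  ... | inj₁ c = codeOnlyNear-u same (next≢ d) c
  ... | inj₂ rest with ∨-true (C (step (next (next d)) u)) rest
  ...   | inj₁ c = codeOnlyNear-u same (next²≢ d) c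
  ...   | inj₂ rest′ with ∨-true (C (step (next d′) v)) rest′
  ...     | inj₁ c = codeOnlyNear-v same (next≢ d′) c
  ...     | inj₂ c = codeOnlyNear-v same (next²≢ d′) c

localId⇒symDiffHasCode : ∀ {C} → LocalIdCode C → ∀ d u → symDiffHasCode C d u ≡ true
localId⇒symDiffHasCode (_ , _ , distinct) d u =
  distinguishes⇒symDiffHasCode _ d u (distinct u (step d u) (adj-step d u))

symDiffHasCode⇒localId : ∀ {C} → Nonempty C → Covering C →
                         (∀ d u → symDiffHasCode C d u ≡ true) → LocalIdCode C
symDiffHasCode⇒localId {C} nonempty covering separated =
  nonempty , covering , λ u v adj → distinct u v (adj⇒step adj)
  where
  distinct : ∀ u v → (∃ λ d → v ≡ step d u) → Distinguishes C u v
  distinct u _ (d , refl) = symDiffHasCode⇒distinguishes C d u (separated d u)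

bit : Bool → ℕ
bit b = if b then 1 else 0

bit-≤1 : ∀ b → bit b ≤ 1
bit-≤1 true  = s≤s z≤n
bit-≤1 false = z≤n

∑-dir : (Dir → ℕ) → ℕ
∑-dir f = f east ℕ.+ f west ℕ.+ f twist

∑-dir-rotate : ∀ d f → ∑-dir f ≡ f d ℕ.+ f (next d) ℕ.+ f (next (next d))
∑-dir-rotate east  f = refl
∑-dir-rotate west  f = rotate (f east) (f west) (f twist)
  where
  rotate : ∀ a b c → a ℕ.+ b ℕ.+ c ≡ b ℕ.+ c ℕ.+ a
  rotate = ℕSolver.solve-∀
∑-dir-rotate twist f = rotate (f east) (f west) (f twist)
  where
  rotate : ∀ a b c → a ℕ.+ b ℕ.+ c ≡ c ℕ.+ a ℕ.+ b
  rotate = ℕSolver.solve-∀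

∑-dir-opposite : ∀ f → ∑-dir (f ∘ opposite) ≡ ∑-dir f
∑-dir-opposite f = cong (ℕ._+ f twist) (ℕP.+-comm (f west) (f east))

∑-dir-mono : ∀ {f g} → (∀ d → f d ≤ g d) → ∑-dir f ≤ ∑-dir g
∑-dir-mono f≤g = ℕP.+-mono-≤ (ℕP.+-mono-≤ (f≤g east) (f≤g west)) (f≤g twist)

∑-dir-*ʳ : ∀ f c → ∑-dir (λ d → f d ℕ.* c) ≡ ∑-dir f ℕ.* c
∑-dir-*ʳ f c = sym (trans (ℕP.*-distribʳ-+ c (f east ℕ.+ f west) (f twist))
                          (cong (ℕ._+ f twist ℕ.* c) (ℕP.*-distribʳ-+ c (f east) (f west))))

∑-dir-*ˡ : ∀ c f → ∑-dir (λ d → c ℕ.* f d) ≡ c ℕ.* ∑-dir f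
∑-dir-*ˡ c f = begin
  ∑-dir (λ d → c ℕ.* f d)  ≡⟨ cong₂ ℕ._+_ (cong₂ ℕ._+_ (ℕP.*-comm c _) (ℕP.*-comm c _)) (ℕP.*-comm c _) ⟩
  ∑-dir (λ d → f d ℕ.* c)  ≡⟨ ∑-dir-*ʳ f c ⟩
  ∑-dir f ℕ.* c            ≡⟨ ℕP.*-comm _ c ⟩
  c ℕ.* ∑-dir f            ∎
  where open ≡-Reasoning

∑-dir-≥ : ∀ e g → g e ≤ ∑-dir g
∑-dir-≥ e g = subst (g e ≤_) (sym (∑-dir-rotate e g)) (ℕP.≤-trans (ℕP.m≤m+n _ _) (ℕP.m≤m+n _ _))

∑-dir-bits-≥1 : ∀ f {e} → f e ≡ true → 1 ≤ ∑-dir (bit ∘ f)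
∑-dir-bits-≥1 f {e} fe = ℕP.≤-trans (ℕP.≤-reflexive (cong bit (sym fe))) (∑-dir-≥ e (bit ∘ f))

∑-dir-bits-≥2 : ∀ f {e e′} → e′ ≢ e → f e ≡ true → f e′ ≡ true → 2 ≤ ∑-dir (bit ∘ f)
∑-dir-bits-≥2 f {e} {e′} e′≢e fe fe′
  rewrite ∑-dir-rotate e (bit ∘ f) | fe with dir-cases e e′
... | inj₁ refl = ⊥-elim (e′≢e refl)
... | inj₂ (inj₁ refl) rewrite fe′ = s≤s (s≤s z≤n)
... | inj₂ (inj₂ refl) rewrite fe′ = s≤s (ℕP.m≤n+m 1 _)

allDir : (Dir → Bool) → Bool
allDir f = f east ∧ f west ∧ f twist

allDir-true : ∀ f → allDir f ≡ true → ∀ d → f d ≡ true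
allDir-true f holds east  with f east | holds
... | true | _ = refl
allDir-true f holds west  with f east | f west | holds
... | true | true | _ = refl
allDir-true f holds twist with f east | f west | f twist | holds
... | true | true | true | _ = refl

allDir-false : ∀ f → allDir f ≡ false → ∃ λ d → f d ≡ false
allDir-false f fails with f east in e | f west in w | f twist in t
... | false | _     | _     = east , e
... | true  | false | _     = west , w
... | true  | true  | false = twist , t

-- Discharging

-- 12 / k for the degrees 1 … 4 that occur in a covering code; the value 0 elsewhere is junk.
fairShare : ℕ → ℕ
fairShare 1 = 12
fairShare 2 = 6
fairShare 3 = 4
fairShare 4 = 3
fairShare _ = 0

*-fairShare : ∀ {k} → 1 ≤ k → k ≤ 4 → k ℕ.* fairShare k ≡ 12
*-fairShare {1} _ _ = refl
*-fairShare {2} _ _ = refl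
*-fairShare {3} _ _ = refl
*-fairShare {4} _ _ = refl
*-fairShare {suc (suc (suc (suc (suc _))))} _ (s≤s (s≤s (s≤s (s≤s ()))))

fairShare-≤12 : ∀ k → fairShare k ≤ 12
fairShare-≤12 0 = z≤n
fairShare-≤12 1 = ℕP.≤-refl
fairShare-≤12 2 = ℕP.m≤m+n 6 6
fairShare-≤12 3 = ℕP.m≤m+n 4 8
fairShare-≤12 4 = ℕP.m≤m+n 3 9
fairShare-≤12 (suc (suc (suc (suc (suc _))))) = z≤n

fairShare-≤6 : ∀ {k} → 2 ≤ k → fairShare k ≤ 6
fairShare-≤6 {1} (s≤s ())
fairShare-≤6 {2} _ = ℕP.≤-refl
fairShare-≤6 {3} _ = ℕP.m≤m+n 4 2
fairShare-≤6 {4} _ = ℕP.m≤m+n 3 3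
fairShare-≤6 {suc (suc (suc (suc (suc _))))} _ = z≤n

fairShare-≤4 : ∀ {k} → 3 ≤ k → fairShare k ≤ 4
fairShare-≤4 {1} (s≤s ())
fairShare-≤4 {2} (s≤s (s≤s ()))
fairShare-≤4 {3} _ = ℕP.≤-refl
fairShare-≤4 {4} _ = ℕP.m≤m+n 3 1
fairShare-≤4 {suc (suc (suc (suc (suc _))))} _ = z≤n

module Discharging (C : Code) where

  codeNeighbours degree : Vertex → ℕ
  codeNeighbours v = ∑-dir (λ d → bit (C (step d v)))
  degree v = bit (C v) ℕ.+ codeNeighbours v

  -- A codeword with a single code neighbour whose two other neighbours are covered by it alone.
  exceptional : Vertex → Bool
  exceptional v = C v ∧ (degree v ≡ᵇ 2) ∧ allDir (λ d → C (step d v) ∨ (degree (step d v) ≡ᵇ 1))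

  -- A vertex v receives share v from each code neighbour and, if it is a codeword, selfShare v
  -- from itself; apart from exceptional vertices the charge 12 is split evenly over I(v).
  share selfShare : Vertex → ℕ
  share v     = if exceptional v then 8 else fairShare (degree v)
  selfShare v = if exceptional v then 4 else fairShare (degree v)

  sent : Dir → Vertex → ℕ
  sent d u = bit (C u) ℕ.* share (step d u)

  kept : Vertex → ℕ
  kept u = bit (C u) ℕ.* selfShare u

  given received : Vertex → ℕ
  given u    = kept u ℕ.+ ∑-dir (λ d → sent d u)
  received v = kept v ℕ.+ ∑-dir (λ d → sent (opposite d) (step d v))

  degree-≤4 : ∀ v → degree v ≤ 4
  degree-≤4 v = ℕP.+-mono-≤ (bit-≤1 (C v)) (∑-dir-mono (λ d → bit-≤1 (C (step d v))))

  degree-≥-codeNeighbour : ∀ {v e} → C (step e v) ≡ true → bit (C v) ℕ.+ 1 ≤ degree v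
  degree-≥-codeNeighbour {v} ce = ℕP.+-monoʳ-≤ (bit (C v)) (∑-dir-bits-≥1 (λ d → C (step d v)) ce)

  degree-≥-codeNeighbours : ∀ {v e e′} → e′ ≢ e → C (step e v) ≡ true → C (step e′ v) ≡ true →
                            bit (C v) ℕ.+ 2 ≤ degree v
  degree-≥-codeNeighbours {v} e′≢e ce ce′ =
    ℕP.+-monoʳ-≤ (bit (C v)) (∑-dir-bits-≥2 (λ d → C (step d v)) e′≢e ce ce′)

  covering⇒degree≥1 : Covering C → ∀ v → 1 ≤ degree v
  covering⇒degree≥1 covering v with covering v
  ... | w , n , w∈C with InN⇒step n
  ...   | inj₁ refl         = ℕP.≤-trans (ℕP.≤-reflexive (cong bit (sym w∈C))) (ℕP.m≤m+n _ _)
  ...   | inj₂ (_ , refl)   = ℕP.≤-trans (ℕP.m≤n+m 1 _) (degree-≥-codeNeighbour w∈C)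

  exceptional⇒ : ∀ v → exceptional v ≡ true → C v ≡ true × degree v ≡ 2
  exceptional⇒ v ex with ∧-true (C v) ex
  ... | v∈C , rest = v∈C , ℕP.≡ᵇ⇒≡ (degree v) 2 (Equivalence.from T-≡ (proj₁ (∧-true (degree v ≡ᵇ 2) rest)))

  shares-if-exceptional : ∀ {v} → exceptional v ≡ true → share v ≡ 8 × selfShare v ≡ 4
  shares-if-exceptional {v} ex =
    cong (if_then 8 else fairShare (degree v)) ex , cong (if_then 4 else fairShare (degree v)) ex

  shares-unless-exceptional : ∀ {v} → exceptional v ≡ false →
                              share v ≡ fairShare (degree v) × selfShare v ≡ fairShare (degree v)
  shares-unless-exceptional {v} ex =
    cong (if_then 8 else fairShare (degree v)) ex , cong (if_then 4 else fairShare (degree v)) ex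

  received≡ : ∀ v → received v ≡ bit (C v) ℕ.* selfShare v ℕ.+ codeNeighbours v ℕ.* share v
  received≡ v = cong (bit (C v) ℕ.* selfShare v ℕ.+_) (begin
    ∑-dir (λ d → bit (C (step d v)) ℕ.* share (step (opposite d) (step d v)))
      ≡⟨ cong₂ ℕ._+_ (cong₂ ℕ._+_ (from east) (from west)) (from twist) ⟩
    ∑-dir (λ d → bit (C (step d v)) ℕ.* share v)
      ≡⟨ ∑-dir-*ʳ (λ d → bit (C (step d v))) (share v) ⟩
    codeNeighbours v ℕ.* share v ∎)
    where
    open ≡-Reasoning
    from : ∀ d → bit (C (step d v)) ℕ.* share (step (opposite d) (step d v)) ≡ bit (C (step d v)) ℕ.* share v
    from d = cong (λ w → bit (C (step d v)) ℕ.* share w) (step-opposite d v)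

  received≡12 : ∀ v → 1 ≤ degree v → received v ≡ 12
  received≡12 v covered with true-or-false (exceptional v)
  ... | inj₁ ex = begin
    received v                                          ≡⟨ received≡ v ⟩
    bit (C v) ℕ.* selfShare v ℕ.+ codeNeighbours v ℕ.* share v
      ≡⟨ cong₂ ℕ._+_ (cong₂ ℕ._*_ (cong bit v∈C) selfShare≡4) (cong₂ ℕ._*_ single share≡8) ⟩
    1 ℕ.* 4 ℕ.+ 1 ℕ.* 8                                 ∎
    where
    open ≡-Reasoning
    v∈C      = proj₁ (exceptional⇒ v ex)
    share≡8     = proj₁ (shares-if-exceptional ex)
    selfShare≡4 = proj₂ (shares-if-exceptional ex)
    single : codeNeighbours v ≡ 1
    single = ℕP.suc-injective (trans (cong (λ b → bit b ℕ.+ codeNeighbours v) (sym v∈C))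
                                     (proj₂ (exceptional⇒ v ex)))
  ... | inj₂ ex = begin
    received v                                          ≡⟨ received≡ v ⟩
    bit (C v) ℕ.* selfShare v ℕ.+ codeNeighbours v ℕ.* share v
      ≡⟨ cong₂ (λ s t → bit (C v) ℕ.* s ℕ.+ codeNeighbours v ℕ.* t) selfShare≡ share≡ ⟩
    bit (C v) ℕ.* fairShare (degree v) ℕ.+ codeNeighbours v ℕ.* fairShare (degree v)
      ≡⟨ ℕP.*-distribʳ-+ (fairShare (degree v)) (bit (C v)) (codeNeighbours v) ⟨
    degree v ℕ.* fairShare (degree v)                   ≡⟨ *-fairShare covered (degree-≤4 v) ⟩
    12                                                  ∎
    where
    open ≡-Reasoning
    share≡     = proj₁ (shares-unless-exceptional ex)
    selfShare≡ = proj₂ (shares-unless-exceptional ex)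

  share-≤12 : ∀ v → share v ≤ 12
  share-≤12 v with true-or-false (exceptional v)
  ... | inj₁ ex = ℕP.≤-trans (ℕP.≤-reflexive (proj₁ (shares-if-exceptional ex))) (ℕP.m≤m+n 8 4)
  ... | inj₂ ex = ℕP.≤-trans (ℕP.≤-reflexive (proj₁ (shares-unless-exceptional ex))) (fairShare-≤12 _)

  share-≤8 : ∀ v → 2 ≤ degree v → share v ≤ 8
  share-≤8 v deg with true-or-false (exceptional v)
  ... | inj₁ ex = ℕP.≤-reflexive (proj₁ (shares-if-exceptional ex))
  ... | inj₂ ex = ℕP.≤-trans (ℕP.≤-reflexive (proj₁ (shares-unless-exceptional ex)))
                           (ℕP.≤-trans (fairShare-≤6 deg) (ℕP.m≤m+n 6 2))

  share-≤6 : ∀ v → C v ≡ false → 2 ≤ degree v → share v ≤ 6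
  share-≤6 v v∉C deg with true-or-false (exceptional v)
  ... | inj₁ ex = ⊥-elim (true≢false (proj₁ (exceptional⇒ v ex)) v∉C)
  ... | inj₂ ex = ℕP.≤-trans (ℕP.≤-reflexive (proj₁ (shares-unless-exceptional ex))) (fairShare-≤6 deg)

  private
    3≰degree-if-exceptional : ∀ v → exceptional v ≡ true → ¬ 3 ≤ degree v
    3≰degree-if-exceptional v ex deg with s≤s (s≤s ()) ← subst (3 ≤_) (proj₂ (exceptional⇒ v ex)) deg

  share-≤4 : ∀ v → 3 ≤ degree v → share v ≤ 4
  share-≤4 v deg with true-or-false (exceptional v)
  ... | inj₁ ex = ⊥-elim (3≰degree-if-exceptional v ex deg)
  ... | inj₂ ex = ℕP.≤-trans (ℕP.≤-reflexive (proj₁ (shares-unless-exceptional ex))) (fairShare-≤4 deg)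

  selfShare-≤4 : ∀ v → 3 ≤ degree v → selfShare v ≤ 4
  selfShare-≤4 v deg with true-or-false (exceptional v)
  ... | inj₁ ex = ⊥-elim (3≰degree-if-exceptional v ex deg)
  ... | inj₂ ex = ℕP.≤-trans (ℕP.≤-reflexive (proj₂ (shares-unless-exceptional ex))) (fairShare-≤4 deg)

  selfShare-≤12 : ∀ v → selfShare v ≤ 12
  selfShare-≤12 v with true-or-false (exceptional v)
  ... | inj₁ ex = ℕP.≤-trans (ℕP.≤-reflexive (proj₂ (shares-if-exceptional ex))) (ℕP.m≤m+n 4 8)
  ... | inj₂ ex = ℕP.≤-trans (ℕP.≤-reflexive (proj₂ (shares-unless-exceptional ex))) (fairShare-≤12 _)

  spent : Vertex → ℕ
  spent c = selfShare c ℕ.+ ∑-dir (λ d → share (step d c))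

  given≡ : ∀ c → given c ≡ bit (C c) ℕ.* spent c
  given≡ c = begin
    bit (C c) ℕ.* selfShare c ℕ.+ ∑-dir (λ d → bit (C c) ℕ.* share (step d c))
      ≡⟨ cong (bit (C c) ℕ.* selfShare c ℕ.+_) (∑-dir-*ˡ (bit (C c)) (λ d → share (step d c))) ⟩
    bit (C c) ℕ.* selfShare c ℕ.+ bit (C c) ℕ.* ∑-dir (λ d → share (step d c))
      ≡⟨ ℕP.*-distribˡ-+ (bit (C c)) (selfShare c) _ ⟨
    bit (C c) ℕ.* spent c ∎
    where open ≡-Reasoning

  module Budget (L : LocalIdCode C) {c : Vertex} (c∈C : C c ≡ true) where

    private
      nbr : Dir → Vertex
      nbr d = step d c

      nbr-sees-c : ∀ d → C (step (opposite d) (nbr d)) ≡ true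
      nbr-sees-c d = subst (λ w → C w ≡ true) (sym (step-opposite d c)) c∈C

    nbr-degree : ∀ d → bit (C (nbr d)) ℕ.+ 1 ≤ degree (nbr d)
    nbr-degree d = degree-≥-codeNeighbour (nbr-sees-c d)

    private
      separated : ∀ d → C (nbr (next d)) ≡ false → C (nbr (next (next d))) ≡ false →
                  C (step (next (opposite d)) (nbr d)) ∨ C (step (next (next (opposite d))) (nbr d)) ≡ true
      separated d n₁ n₂ =
        subst₂ (λ a b → a ∨ b ∨ C (step (next (opposite d)) (nbr d)) ∨ C (step (next (next (opposite d))) (nbr d)) ≡ true)
               n₁ n₂ (localId⇒symDiffHasCode L d c)

    -- Separating c from nbr d needs a codeword next to nbr d other than c.
    alone-nbr-degree : ∀ d → C (nbr (next d)) ≡ false → C (nbr (next (next d))) ≡ false →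
                       bit (C (nbr d)) ℕ.+ 2 ≤ degree (nbr d)
    alone-nbr-degree d n₁ n₂ with ∨-true _ (separated d n₁ n₂)
    ... | inj₁ c₁ = degree-≥-codeNeighbours (next≢ (opposite d)) (nbr-sees-c d) c₁
    ... | inj₂ c₂ = degree-≥-codeNeighbours (next²≢ (opposite d)) (nbr-sees-c d) c₂

    share-≤8-code : ∀ d → C (nbr d) ≡ true → share (nbr d) ≤ 8
    share-≤8-code d nd = share-≤8 (nbr d) (subst (λ b → bit b ℕ.+ 1 ≤ degree (nbr d)) nd (nbr-degree d))

    share-≤4-alone : ∀ d → C (nbr d) ≡ true → C (nbr (next d)) ≡ false → C (nbr (next (next d))) ≡ false →
                     share (nbr d) ≤ 4
    share-≤4-alone d nd n₁ n₂ =
      share-≤4 (nbr d) (subst (λ b → bit b ℕ.+ 2 ≤ degree (nbr d)) nd (alone-nbr-degree d n₁ n₂))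

    share-≤6-alone : ∀ d → C (nbr d) ≡ false → C (nbr (next d)) ≡ false → C (nbr (next (next d))) ≡ false →
                     share (nbr d) ≤ 6
    share-≤6-alone d nd n₁ n₂ =
      share-≤6 (nbr d) nd (subst (λ b → bit b ℕ.+ 2 ≤ degree (nbr d)) nd (alone-nbr-degree d n₁ n₂))

    share-≤6-unless-lonely : ∀ d → C (nbr d) ≡ false → (degree (nbr d) ≡ᵇ 1) ≡ false → share (nbr d) ≤ 6
    share-≤6-unless-lonely d nd notLonely = share-≤6 (nbr d) nd (ℕP.≤∧≢⇒< covered (≢1 ∘ sym))
      where
      covered : 1 ≤ degree (nbr d)
      covered = subst (λ b → bit b ℕ.+ 1 ≤ degree (nbr d)) nd (nbr-degree d)
      ≢1 : degree (nbr d) ≢ 1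
      ≢1 deg≡1 = true≢false (cong (ℕ._≡ᵇ 1) deg≡1) notLonely

    spent-≤ : ∀ d {a b₀ b₁ b₂} → selfShare c ≤ a → share (nbr d) ≤ b₀ → share (nbr (next d)) ≤ b₁ →
              share (nbr (next (next d))) ≤ b₂ → spent c ≤ a ℕ.+ (b₀ ℕ.+ b₁ ℕ.+ b₂)
    spent-≤ d {a} {b₀} {b₁} {b₂} s≤ b₀≤ b₁≤ b₂≤ =
      subst (_≤ a ℕ.+ (b₀ ℕ.+ b₁ ℕ.+ b₂)) (sym (cong (selfShare c ℕ.+_) (∑-dir-rotate d (share ∘ nbr))))
            (ℕP.+-mono-≤ s≤ (ℕP.+-mono-≤ (ℕP.+-mono-≤ b₀≤ b₁≤) b₂≤))

    spent-isolated : C (nbr east) ≡ false → C (nbr west) ≡ false → C (nbr twist) ≡ false → spent c ≤ 32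
    spent-isolated e w t = ℕP.≤-trans
      (spent-≤ east (selfShare-≤12 c) (share-≤6-alone east e w t) (share-≤6-alone west w t e)
                    (share-≤6-alone twist t e w))
      (ℕP.m≤m+n 30 2)

    private
      degree-rotate : ∀ d {a b₀ b₁ b₂} → C c ≡ a → C (nbr d) ≡ b₀ → C (nbr (next d)) ≡ b₁ →
                      C (nbr (next (next d))) ≡ b₂ → degree c ≡ bit a ℕ.+ (bit b₀ ℕ.+ bit b₁ ℕ.+ bit b₂)
      degree-rotate d refl refl refl refl = cong (bit (C c) ℕ.+_) (∑-dir-rotate d (λ e → bit (C (nbr e))))

    spent-one-ordinary : ∀ d → C (nbr d) ≡ true → C (nbr (next d)) ≡ false → C (nbr (next (next d))) ≡ false →
                         exceptional c ≡ false → spent c ≤ 32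
    spent-one-ordinary d nd n₁ n₂ ex = bound (allDir-false _ someNeighbourNotLonely)
      where
      degree≡2 : degree c ≡ 2
      degree≡2 = degree-rotate d c∈C nd n₁ n₂
      selfShare≤6 : selfShare c ≤ 6
      selfShare≤6 = ℕP.≤-reflexive (trans (proj₂ (shares-unless-exceptional ex)) (cong fairShare degree≡2))
      someNeighbourNotLonely : allDir (λ e → C (nbr e) ∨ (degree (nbr e) ≡ᵇ 1)) ≡ false
      someNeighbourNotLonely =
        subst₂ (λ a k → a ∧ (k ≡ᵇ 2) ∧ allDir (λ e → C (nbr e) ∨ (degree (nbr e) ≡ᵇ 1)) ≡ false) c∈C degree≡2 ex
      bound : (∃ λ e → C (nbr e) ∨ (degree (nbr e) ≡ᵇ 1) ≡ false) → spent c ≤ 32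
      bound (e , notLonely) with ∨-false (C (nbr e)) notLonely | dir-cases d e
      ... | ne , _   | inj₁ refl        = ⊥-elim (true≢false nd ne)
      ... | ne , deg | inj₂ (inj₁ refl) = ℕP.≤-trans
            (spent-≤ d selfShare≤6 (share-≤4-alone d nd n₁ n₂) (share-≤6-unless-lonely e ne deg) (share-≤12 _))
            (ℕP.m≤m+n 28 4)
      ... | ne , deg | inj₂ (inj₂ refl) = ℕP.≤-trans
            (spent-≤ d selfShare≤6 (share-≤4-alone d nd n₁ n₂) (share-≤12 _) (share-≤6-unless-lonely e ne deg))
            (ℕP.m≤m+n 28 4)

    spent-one : ∀ d → C (nbr d) ≡ true → C (nbr (next d)) ≡ false → C (nbr (next (next d))) ≡ false →
                spent c ≤ 32
    spent-one d nd n₁ n₂ with true-or-false (exceptional c)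
    ... | inj₁ ex = spent-≤ d (ℕP.≤-reflexive (proj₂ (shares-if-exceptional ex)))
                    (share-≤4-alone d nd n₁ n₂) (share-≤12 _) (share-≤12 _)
    ... | inj₂ ex = spent-one-ordinary d nd n₁ n₂ ex

    spent-two : ∀ d → C (nbr (next d)) ≡ true → C (nbr (next (next d))) ≡ true → spent c ≤ 32
    spent-two d n₁ n₂ =
      spent-≤ d (selfShare-≤4 c degree≥3) (share-≤12 _) (share-≤8-code (next d) n₁) (share-≤8-code (next (next d)) n₂)
      where
      degree≥3 : 3 ≤ degree c
      degree≥3 = subst (λ b → bit b ℕ.+ 2 ≤ degree c) c∈C (degree-≥-codeNeighbours (next≢ (next d)) n₁ n₂)

    spent-≤32 : spent c ≤ 32
    spent-≤32 with true-or-false (C (nbr east)) | true-or-false (C (nbr west)) | true-or-false (C (nbr twist))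
    ... | inj₂ e | inj₂ w | inj₂ t = spent-isolated e w t
    ... | inj₁ e | inj₂ w | inj₂ t = spent-one east e w t
    ... | inj₂ e | inj₁ w | inj₂ t = spent-one west w t e
    ... | inj₂ e | inj₂ w | inj₁ t = spent-one twist t e w
    ... | inj₁ e | inj₁ w | _      = spent-two twist e w
    ... | inj₁ e | _      | inj₁ t = spent-two west t e
    ... | _      | inj₁ w | inj₁ t = spent-two east w t

  given-≤ : LocalIdCode C → ∀ c → given c ≤ 32 ℕ.* bit (C c)
  given-≤ L c = subst (_≤ 32 ℕ.* bit (C c)) (sym (given≡ c)) (bound (C c) refl)
    where
    bound : ∀ b → C c ≡ b → bit b ℕ.* spent c ≤ 32 ℕ.* bit b
    bound true  c∈C = subst (_≤ 32) (sym (ℕP.*-identityˡ (spent c))) (Budget.spent-≤32 L c∈C)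
    bound false _   = z≤n

-- Sums over boxes

∑ : ℕ → (ℕ → ℕ) → ℕ
∑ zero    g = 0
∑ (suc m) g = g 0 ℕ.+ ∑ m (g ∘ suc)

syntax ∑ m (λ k → e) = ∑[ k < m ] e

∑-cong : ∀ m {f g} → (∀ k → f k ≡ g k) → ∑ m f ≡ ∑ m g
∑-cong zero    f≡g = refl
∑-cong (suc m) f≡g = cong₂ ℕ._+_ (f≡g 0) (∑-cong m (f≡g ∘ suc))

∑-mono : ∀ m {f g} → (∀ k → k ℕ.< m → f k ≤ g k) → ∑ m f ≤ ∑ m g
∑-mono zero    f≤g = z≤n
∑-mono (suc m) f≤g = ℕP.+-mono-≤ (f≤g 0 (s≤s z≤n)) (∑-mono m (λ k k<m → f≤g (suc k) (s≤s k<m)))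

∑-+ : ∀ m f g → ∑[ k < m ] (f k ℕ.+ g k) ≡ ∑ m f ℕ.+ ∑ m g
∑-+ zero    f g = refl
∑-+ (suc m) f g = trans (cong (f 0 ℕ.+ g 0 ℕ.+_) (∑-+ m (f ∘ suc) (g ∘ suc)))
                        (interchange (f 0) (g 0) _ _)
  where
  interchange : ∀ a b c d → a ℕ.+ b ℕ.+ (c ℕ.+ d) ≡ a ℕ.+ c ℕ.+ (b ℕ.+ d)
  interchange = ℕSolver.solve-∀

∑-*ˡ : ∀ m c f → ∑[ k < m ] (c ℕ.* f k) ≡ c ℕ.* ∑ m f
∑-*ˡ zero    c f = sym (ℕP.*-zeroʳ c)
∑-*ˡ (suc m) c f = trans (cong (c ℕ.* f 0 ℕ.+_) (∑-*ˡ m c (f ∘ suc))) (sym (ℕP.*-distribˡ-+ c (f 0) _))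

∑-const : ∀ m c → ∑[ k < m ] c ≡ c ℕ.* m
∑-const zero    c = sym (ℕP.*-zeroʳ c)
∑-const (suc m) c = trans (cong (c ℕ.+_) (∑-const m c)) (sym (ℕP.*-suc c m))

∑-++ : ∀ m p g → ∑ (m ℕ.+ p) g ≡ ∑ m g ℕ.+ ∑[ k < p ] g (m ℕ.+ k)
∑-++ zero    p g = refl
∑-++ (suc m) p g = trans (cong (g 0 ℕ.+_) (∑-++ m p (g ∘ suc))) (sym (ℕP.+-assoc (g 0) _ _))

∑-window : ∀ d L e g → ∑[ k < L ] g (d ℕ.+ k) ≤ ∑ (d ℕ.+ (L ℕ.+ e)) g
∑-window d L e g = begin
  ∑[ k < L ] g (d ℕ.+ k)                                              ≤⟨ ℕP.m≤m+n _ _ ⟩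
  ∑[ k < L ] g (d ℕ.+ k) ℕ.+ ∑[ k < e ] g (d ℕ.+ (L ℕ.+ k))           ≡⟨ ∑-++ L e (λ k → g (d ℕ.+ k)) ⟨
  ∑[ k < L ℕ.+ e ] g (d ℕ.+ k)                                        ≤⟨ ℕP.m≤n+m _ _ ⟩
  ∑ d g ℕ.+ ∑[ k < L ℕ.+ e ] g (d ℕ.+ k)                              ≡⟨ ∑-++ d (L ℕ.+ e) g ⟨
  ∑ (d ℕ.+ (L ℕ.+ e)) g                                               ∎
  where open ℕP.≤-Reasoning

width : ℕ → ℕ
width n = suc (2 ℕ.* n)

coord : ℕ → ℕ → ℤ
coord n k = + k - + n

boxSum : (Vertex → ℕ) → ℕ → ℕ
boxSum f n = sum (map f (box n))

private
  sum-map-applyUpTo : ∀ {A : Set} (g : A → ℕ) (φ : ℕ → A) m → sum (map g (applyUpTo φ m)) ≡ ∑ m (g ∘ φ)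
  sum-map-applyUpTo g φ zero    = refl
  sum-map-applyUpTo g φ (suc m) = cong (g (φ 0) ℕ.+_) (sum-map-applyUpTo g (φ ∘ suc) m)

  sum-map-range : ∀ (g : ℤ → ℕ) n → sum (map g (range n)) ≡ ∑[ k < width n ] g (coord n k)
  sum-map-range g n = trans (cong sum (sym (map-∘ {g = g} {f = coord n} (applyUpTo (λ k → k) (width n)))))
                            (sum-map-applyUpTo (g ∘ coord n) (λ k → k) (width n))

  sum-map-concatMap : ∀ {A B : Set} (f : B → ℕ) (h : A → List B) xs →
                      sum (map f (concatMap h xs)) ≡ sum (map (λ x → sum (map f (h x))) xs)
  sum-map-concatMap f h []       = refl
  sum-map-concatMap f h (x ∷ xs) = begin
    sum (map f (h x ++ concatMap h xs))               ≡⟨ cong sum (map-++ f (h x) _) ⟩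
    sum (map f (h x) ++ map f (concatMap h xs))       ≡⟨ sum-++ (map f (h x)) _ ⟩
    sum (map f (h x)) ℕ.+ sum (map f (concatMap h xs))          ≡⟨ cong (sum (map f (h x)) ℕ.+_) (sum-map-concatMap f h xs) ⟩
    sum (map f (h x)) ℕ.+ sum (map (λ x → sum (map f (h x))) xs) ∎
    where open ≡-Reasoning

boxSum≡∑∑ : ∀ f n → boxSum f n ≡ ∑[ k < width n ] ∑[ l < width n ] f (coord n k , coord n l)
boxSum≡∑∑ f n = begin
  sum (map f (concatMap row (range n)))                            ≡⟨ sum-map-concatMap f row (range n) ⟩
  sum (map (λ i → sum (map f (row i))) (range n))                  ≡⟨ cong sum (map-cong rowSum (range n)) ⟩
  sum (map (λ i → ∑[ l < width n ] f (i , coord n l)) (range n))   ≡⟨ sum-map-range _ n ⟩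
  ∑[ k < width n ] ∑[ l < width n ] f (coord n k , coord n l)      ∎
  where
  open ≡-Reasoning
  row : ℤ → List Vertex
  row i = map (i ,_) (range n)
  rowSum : ∀ i → sum (map f (row i)) ≡ ∑[ l < width n ] f (i , coord n l)
  rowSum i = trans (cong sum (sym (map-∘ (range n)))) (sum-map-range (λ j → f (i , j)) n)

boxSum-cong : ∀ n {f g} → (∀ v → f v ≡ g v) → boxSum f n ≡ boxSum g n
boxSum-cong n f≡g = cong sum (map-cong f≡g (box n))

boxSum-mono : ∀ n {f g} → (∀ v → f v ≤ g v) → boxSum f n ≤ boxSum g n
boxSum-mono n {f} {g} f≤g = subst₂ _≤_ (sym (boxSum≡∑∑ f n)) (sym (boxSum≡∑∑ g n))
  (∑-mono (width n) (λ k _ → ∑-mono (width n) (λ l _ → f≤g (coord n k , coord n l))))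

boxSum-+ : ∀ n f g → boxSum (λ v → f v ℕ.+ g v) n ≡ boxSum f n ℕ.+ boxSum g n
boxSum-+ n f g = begin
  boxSum (λ v → f v ℕ.+ g v) n
    ≡⟨ boxSum≡∑∑ _ n ⟩
  ∑[ k < width n ] ∑[ l < width n ] (f (x k , x l) ℕ.+ g (x k , x l))
    ≡⟨ ∑-cong (width n) (λ k → ∑-+ (width n) (λ l → f (x k , x l)) (λ l → g (x k , x l))) ⟩
  ∑[ k < width n ] (∑[ l < width n ] f (x k , x l) ℕ.+ ∑[ l < width n ] g (x k , x l))
    ≡⟨ ∑-+ (width n) (λ k → ∑[ l < width n ] f (x k , x l)) (λ k → ∑[ l < width n ] g (x k , x l)) ⟩
  ∑[ k < width n ] ∑[ l < width n ] f (x k , x l) ℕ.+ ∑[ k < width n ] ∑[ l < width n ] g (x k , x l)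
    ≡⟨ cong₂ ℕ._+_ (boxSum≡∑∑ f n) (boxSum≡∑∑ g n) ⟨
  boxSum f n ℕ.+ boxSum g n ∎
  where
  open ≡-Reasoning
  x = coord n

boxSum-*ˡ : ∀ n c f → boxSum (λ v → c ℕ.* f v) n ≡ c ℕ.* boxSum f n
boxSum-*ˡ n c f = begin
  boxSum (λ v → c ℕ.* f v) n
    ≡⟨ boxSum≡∑∑ _ n ⟩
  ∑[ k < width n ] ∑[ l < width n ] (c ℕ.* f (x k , x l))
    ≡⟨ ∑-cong (width n) (λ k → ∑-*ˡ (width n) c (λ l → f (x k , x l))) ⟩
  ∑[ k < width n ] (c ℕ.* ∑[ l < width n ] f (x k , x l))
    ≡⟨ ∑-*ˡ (width n) c (λ k → ∑[ l < width n ] f (x k , x l)) ⟩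
  c ℕ.* ∑[ k < width n ] ∑[ l < width n ] f (x k , x l)
    ≡⟨ cong (c ℕ.*_) (boxSum≡∑∑ f n) ⟨
  c ℕ.* boxSum f n ∎
  where
  open ≡-Reasoning
  x = coord n

boxSum-const : ∀ n c → boxSum (λ _ → c) n ≡ c ℕ.* sizeQ n
boxSum-const n c = begin
  boxSum (λ _ → c) n                         ≡⟨ boxSum≡∑∑ _ n ⟩
  ∑[ k < width n ] ∑[ l < width n ] c        ≡⟨ ∑-cong (width n) (λ _ → ∑-const (width n) c) ⟩
  ∑[ k < width n ] (c ℕ.* width n)           ≡⟨ ∑-const (width n) (c ℕ.* width n) ⟩
  c ℕ.* width n ℕ.* width n                  ≡⟨ square c n ⟩
  c ℕ.* sizeQ n                              ∎
  where
  open ≡-Reasoning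
  square : ∀ c n → c ℕ.* suc (2 ℕ.* n) ℕ.* suc (2 ℕ.* n) ≡ c ℕ.* suc (4 ℕ.* n ℕ.* n ℕ.+ 4 ℕ.* n)
  square = ℕSolver.solve-∀

boxSum-∑ : ∀ n m (F : ℕ → Vertex → ℕ) → boxSum (λ v → ∑[ k < m ] F k v) n ≡ ∑[ k < m ] boxSum (F k) n
boxSum-∑ n zero    F = trans (boxSum-const n 0) refl
boxSum-∑ n (suc m) F = trans (boxSum-+ n (F 0) (λ v → ∑[ k < m ] F (suc k) v)) (cong (boxSum (F 0) n ℕ.+_) (boxSum-∑ n m (F ∘ suc)))

_+ᵥ_ : Vertex → Vertex → Vertex
(i , j) +ᵥ (a , b) = (i + a , j + b)

private
  offset : ∀ {a R} → ∣ a ∣ ≤ R → ∃₂ λ d e → d ℕ.+ e ≡ R ℕ.+ R × a ≡ + d - + R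
  offset {+ m} m≤R with ℕP.m≤n⇒∃[o]m+o≡n m≤R
  ... | t , refl = m ℕ.+ t ℕ.+ m , t , sum≡ m t , sym shift
    where
    sum≡ : ∀ m t → m ℕ.+ t ℕ.+ m ℕ.+ t ≡ m ℕ.+ t ℕ.+ (m ℕ.+ t)
    sum≡ = ℕSolver.solve-∀
    shift : + (m ℕ.+ t ℕ.+ m) - + (m ℕ.+ t) ≡ + m
    shift rewrite ℤP.pos-+ (m ℕ.+ t) m | ℤP.pos-+ m t = cancel (+ m) (+ t)
      where
      cancel : ∀ x y → x + y + x - (x + y) ≡ x
      cancel = solve-∀
  offset { -[1+ m ]} sm≤R with ℕP.m≤n⇒∃[o]m+o≡n sm≤R
  ... | t , refl = t , suc m ℕ.+ t ℕ.+ suc m , sum≡ (suc m) t , sym shift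
    where
    sum≡ : ∀ m t → t ℕ.+ (m ℕ.+ t ℕ.+ m) ≡ m ℕ.+ t ℕ.+ (m ℕ.+ t)
    sum≡ = ℕSolver.solve-∀
    shift : + t - + (suc m ℕ.+ t) ≡ - + suc m
    shift rewrite ℤP.pos-+ (suc m) t = cancel (+ suc m) (+ t)
      where
      cancel : ∀ x y → y - (x + y) ≡ - x
      cancel = solve-∀

  coord-shift : ∀ n R d k → coord n k + (+ d - + R) ≡ coord (R ℕ.+ n) (d ℕ.+ k)
  coord-shift n R d k rewrite ℤP.pos-+ d k | ℤP.pos-+ R n = shuffle (+ k) (+ n) (+ d) (+ R)
    where
    shuffle : ∀ k n d R → k - n + (d - R) ≡ d + k - (R + n)
    shuffle = solve-∀

  width-split : ∀ n R d e → d ℕ.+ e ≡ R ℕ.+ R → d ℕ.+ (width n ℕ.+ e) ≡ width (R ℕ.+ n)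
  width-split n R d e d+e = begin
    d ℕ.+ (width n ℕ.+ e)   ≡⟨ swap d (width n) e ⟩
    width n ℕ.+ (d ℕ.+ e)   ≡⟨ cong (width n ℕ.+_) d+e ⟩
    width n ℕ.+ (R ℕ.+ R)   ≡⟨ widen n R ⟩
    width (R ℕ.+ n)         ∎
    where
    open ≡-Reasoning
    swap : ∀ d w e → d ℕ.+ (w ℕ.+ e) ≡ w ℕ.+ (d ℕ.+ e)
    swap = ℕSolver.solve-∀
    widen : ∀ n R → suc (2 ℕ.* n) ℕ.+ (R ℕ.+ R) ≡ suc (2 ℕ.* (R ℕ.+ n))
    widen = ℕSolver.solve-∀

∑-coord-translate : ∀ G n R a → ∣ a ∣ ≤ R →
                    ∑[ k < width n ] G (coord n k + a) ≤ ∑[ k < width (R ℕ.+ n) ] G (coord (R ℕ.+ n) k)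
∑-coord-translate G n R a a≤R with offset {a} a≤R
... | d , e , d+e , refl = begin
  ∑[ k < width n ] G (coord n k + (+ d - + R))         ≡⟨ ∑-cong (width n) (cong G ∘ coord-shift n R d) ⟩
  ∑[ k < width n ] G (coord (R ℕ.+ n) (d ℕ.+ k))       ≤⟨ ∑-window d (width n) e (G ∘ coord (R ℕ.+ n)) ⟩
  ∑ (d ℕ.+ (width n ℕ.+ e)) (G ∘ coord (R ℕ.+ n))      ≡⟨ cong (λ m → ∑ m (G ∘ coord (R ℕ.+ n))) (width-split n R d e d+e) ⟩
  ∑[ k < width (R ℕ.+ n) ] G (coord (R ℕ.+ n) k)       ∎
  where open ℕP.≤-Reasoning

boxSum-translate : ∀ f n R δ → ∣ proj₁ δ ∣ ≤ R → ∣ proj₂ δ ∣ ≤ R →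
                   boxSum (λ v → f (v +ᵥ δ)) n ≤ boxSum f (R ℕ.+ n)
boxSum-translate f n R (a , b) a≤R b≤R = begin
  boxSum (λ v → f (v +ᵥ (a , b))) n
    ≡⟨ boxSum≡∑∑ _ n ⟩
  ∑[ k < width n ] ∑[ l < width n ] f (coord n k + a , coord n l + b)
    ≤⟨ ∑-mono (width n) (λ k _ → ∑-coord-translate (λ y → f (coord n k + a , y)) n R b b≤R) ⟩
  ∑[ k < width n ] ∑[ l < width n′ ] f (coord n k + a , coord n′ l)
    ≤⟨ ∑-coord-translate (λ x → ∑[ l < width n′ ] f (x , coord n′ l)) n R a a≤R ⟩
  ∑[ k < width n′ ] ∑[ l < width n′ ] f (coord n′ k , coord n′ l)
    ≡⟨ boxSum≡∑∑ f n′ ⟨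
  boxSum f n′ ∎
  where
  open ℕP.≤-Reasoning
  n′ = R ℕ.+ n

private
  positive : ℤ → Bool
  positive (+ suc _) = true
  positive _         = false

  keepIf dropIf : Bool → ℕ → ℕ
  keepIf b x = if b then x else 0
  dropIf b x = if b then 0 else x

  keep+drop : ∀ b x → x ≡ keepIf b x ℕ.+ dropIf b x
  keep+drop true  x = sym (ℕP.+-identityʳ x)
  keep+drop false x = refl

  -- step twist moves a vertex of positive orientation one row down and one of negative orientation
  -- one row up, so splitting f by orientation makes f ∘ step twist a sum of two translates.
  f⁺ f⁻ : (Vertex → ℕ) → Vertex → ℕ
  f⁺ f v = keepIf (positive (orientation v)) (f v)
  f⁻ f v = dropIf (positive (orientation v)) (f v)

  twist-f⁻ : ∀ f v → f⁻ f (step twist v) ≤ f⁻ f (v +ᵥ (+ 0 , -[1+ 0 ]))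
  twist-f⁻ f (i , j) with neg1pow≡±1 (i + j + + 1)
  ... | inj₁ o≡1  = ℕP.≤-reflexive (cong (f⁻ f) (cong₂ _,_ (sym (ℤP.+-identityʳ i)) (cong (λ o → j - o) o≡1)))
  ... | inj₂ o≡-1 = subst (λ o → dropIf (positive o) (f (step twist (i , j))) ≤ f⁻ f ((i , j) +ᵥ (+ 0 , -[1+ 0 ])))
                          (sym (trans (orientation-step twist (i , j)) (cong -_ o≡-1))) z≤n

  twist-f⁺ : ∀ f v → f⁺ f (step twist v) ≤ f⁺ f (v +ᵥ (+ 0 , + 1))
  twist-f⁺ f (i , j) with neg1pow≡±1 (i + j + + 1)
  ... | inj₁ o≡1  = subst (λ o → keepIf (positive o) (f (step twist (i , j))) ≤ f⁺ f ((i , j) +ᵥ (+ 0 , + 1)))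
                          (sym (trans (orientation-step twist (i , j)) (cong -_ o≡1))) z≤n
  ... | inj₂ o≡-1 = ℕP.≤-reflexive (cong (f⁺ f) (cong₂ _,_ (sym (ℤP.+-identityʳ i)) (cong (λ o → j - o) o≡-1)))

boxSum-∘-step : ∀ d f n → boxSum (f ∘ step d) n ≤ boxSum f (suc n)
boxSum-∘-step east f n =
  subst (_≤ boxSum f (suc n))
        (boxSum-cong n {g = f ∘ step east} (λ (i , j) → cong (λ y → f (i + + 1 , y)) (ℤP.+-identityʳ j)))
        (boxSum-translate f n 1 (+ 1 , + 0) ℕP.≤-refl z≤n)
boxSum-∘-step west f n =
  subst (_≤ boxSum f (suc n))
        (boxSum-cong n {g = f ∘ step west} (λ (i , j) → cong (λ y → f (i - + 1 , y)) (ℤP.+-identityʳ j)))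
        (boxSum-translate f n 1 (-[1+ 0 ] , + 0) ℕP.≤-refl z≤n)
boxSum-∘-step twist f n = begin
  boxSum (f ∘ step twist) n
    ≡⟨ boxSum-cong n {g = λ v → f⁺ f (step twist v) ℕ.+ f⁻ f (step twist v)}
                   (λ v → keep+drop (positive (orientation (step twist v))) (f (step twist v))) ⟩
  boxSum (λ v → f⁺ f (step twist v) ℕ.+ f⁻ f (step twist v)) n
    ≡⟨ boxSum-+ n (f⁺ f ∘ step twist) (f⁻ f ∘ step twist) ⟩
  boxSum (f⁺ f ∘ step twist) n ℕ.+ boxSum (f⁻ f ∘ step twist) n
    ≤⟨ ℕP.+-mono-≤ (boxSum-mono n (twist-f⁺ f)) (boxSum-mono n (twist-f⁻ f)) ⟩
  boxSum (λ v → f⁺ f (v +ᵥ (+ 0 , + 1))) n ℕ.+ boxSum (λ v → f⁻ f (v +ᵥ (+ 0 , -[1+ 0 ]))) n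
    ≤⟨ ℕP.+-mono-≤ (boxSum-translate (f⁺ f) n 1 (+ 0 , + 1) z≤n ℕP.≤-refl)
                   (boxSum-translate (f⁻ f) n 1 (+ 0 , -[1+ 0 ]) z≤n ℕP.≤-refl) ⟩
  boxSum (f⁺ f) (suc n) ℕ.+ boxSum (f⁻ f) (suc n)
    ≡⟨ boxSum-+ (suc n) (f⁺ f) (f⁻ f) ⟨
  boxSum (λ v → f⁺ f v ℕ.+ f⁻ f v) (suc n)
    ≡⟨ boxSum-cong (suc n) {f = f} (λ v → keep+drop (positive (orientation v)) (f v)) ⟨
  boxSum f (suc n) ∎
  where open ℕP.≤-Reasoning

boxSum-∑-dir : ∀ n (F : Dir → Vertex → ℕ) → boxSum (λ v → ∑-dir (λ d → F d v)) n ≡ ∑-dir (λ d → boxSum (F d) n)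
boxSum-∑-dir n F =
  trans (boxSum-+ n (λ v → F east v ℕ.+ F west v) (F twist))
        (cong (ℕ._+ boxSum (F twist) n) (boxSum-+ n (F east) (F west)))

boxSum-≤-suc : ∀ f n → boxSum f n ≤ boxSum f (suc n)
boxSum-≤-suc f n =
  subst (_≤ boxSum f (suc n)) (boxSum-cong n {g = f} (λ (i , j) → cong₂ (λ x y → f (x , y)) (ℤP.+-identityʳ i) (ℤP.+-identityʳ j)))
        (boxSum-translate f n 1 (+ 0 , + 0) z≤n z≤n)

module _ (C : Code) where
  open Discharging C

  boxSum-received≤given : ∀ n → boxSum received n ≤ boxSum given (suc n)
  boxSum-received≤given n = begin
    boxSum received n
      ≡⟨ boxSum-+ n kept _ ⟩
    boxSum kept n ℕ.+ boxSum (λ v → ∑-dir (λ d → sent (opposite d) (step d v))) n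
      ≡⟨ cong (boxSum kept n ℕ.+_) (boxSum-∑-dir n (λ d v → sent (opposite d) (step d v))) ⟩
    boxSum kept n ℕ.+ ∑-dir (λ d → boxSum (sent (opposite d) ∘ step d) n)
      ≤⟨ ℕP.+-mono-≤ (boxSum-≤-suc kept n) (∑-dir-mono (λ d → boxSum-∘-step d (sent (opposite d)) n)) ⟩
    boxSum kept (suc n) ℕ.+ ∑-dir (λ d → boxSum (sent (opposite d)) (suc n))
      ≡⟨ cong (boxSum kept (suc n) ℕ.+_) (∑-dir-opposite (λ d → boxSum (sent d) (suc n))) ⟩
    boxSum kept (suc n) ℕ.+ ∑-dir (λ d → boxSum (sent d) (suc n))
      ≡⟨ cong (boxSum kept (suc n) ℕ.+_) (boxSum-∑-dir (suc n) sent) ⟨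
    boxSum kept (suc n) ℕ.+ boxSum (λ u → ∑-dir (λ d → sent d u)) (suc n)
      ≡⟨ boxSum-+ (suc n) kept _ ⟨
    boxSum given (suc n) ∎
    where open ℕP.≤-Reasoning

  lower-bound : LocalIdCode C → ∀ n → 12 ℕ.* sizeQ n ≤ 32 ℕ.* countIn C (suc n)
  lower-bound L@(_ , covering , _) n = begin
    12 ℕ.* sizeQ n                        ≡⟨ boxSum-const n 12 ⟨
    boxSum (λ _ → 12) n                   ≡⟨ boxSum-cong n (λ v → received≡12 v (covering⇒degree≥1 covering v)) ⟨
    boxSum received n                     ≤⟨ boxSum-received≤given n ⟩
    boxSum given (suc n)                  ≤⟨ boxSum-mono (suc n) (given-≤ L) ⟩
    boxSum (λ c → 32 ℕ.* bit (C c)) (suc n) ≡⟨ boxSum-*ˡ (suc n) 32 (λ c → bit (C c)) ⟩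
    32 ℕ.* countIn C (suc n)              ∎
    where open ℕP.≤-Reasoning

-- A periodic code of density 3/8

data ℤ₈ : Set where
  r0 r1 r2 r3 r4 r5 r6 r7 : ℤ₈

suc₈ pred₈ : ℤ₈ → ℤ₈
suc₈ r0 = r1
suc₈ r1 = r2
suc₈ r2 = r3
suc₈ r3 = r4
suc₈ r4 = r5
suc₈ r5 = r6
suc₈ r6 = r7
suc₈ r7 = r0
pred₈ r0 = r7
pred₈ r1 = r0
pred₈ r2 = r1
pred₈ r3 = r2
pred₈ r4 = r3
pred₈ r5 = r4
pred₈ r6 = r5
pred₈ r7 = r6

add4 : ℤ₈ → ℤ₈
add4 = suc₈ ∘ suc₈ ∘ suc₈ ∘ suc₈

_+₈_ : ℤ₈ → ℕ → ℤ₈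
r +₈ zero  = r
r +₈ suc k = suc₈ (r +₈ k)

suc₈-pred₈ : ∀ r → suc₈ (pred₈ r) ≡ r
suc₈-pred₈ r0 = refl
suc₈-pred₈ r1 = refl
suc₈-pred₈ r2 = refl
suc₈-pred₈ r3 = refl
suc₈-pred₈ r4 = refl
suc₈-pred₈ r5 = refl
suc₈-pred₈ r6 = refl
suc₈-pred₈ r7 = refl

pred₈-suc₈ : ∀ r → pred₈ (suc₈ r) ≡ r
pred₈-suc₈ r0 = refl
pred₈-suc₈ r1 = refl
pred₈-suc₈ r2 = refl
pred₈-suc₈ r3 = refl
pred₈-suc₈ r4 = refl
pred₈-suc₈ r5 = refl
pred₈-suc₈ r6 = refl
pred₈-suc₈ r7 = refl

pred₈⁴≡add4 : ∀ r → pred₈ (pred₈ (pred₈ (pred₈ r))) ≡ add4 r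
pred₈⁴≡add4 r0 = refl
pred₈⁴≡add4 r1 = refl
pred₈⁴≡add4 r2 = refl
pred₈⁴≡add4 r3 = refl
pred₈⁴≡add4 r4 = refl
pred₈⁴≡add4 r5 = refl
pred₈⁴≡add4 r6 = refl
pred₈⁴≡add4 r7 = refl

toℤ₈ : ℤ → ℤ₈
toℤ₈ (+ zero)     = r0
toℤ₈ (+ suc n)    = suc₈ (toℤ₈ (+ n))
toℤ₈ -[1+ zero ]  = r7
toℤ₈ -[1+ suc n ] = pred₈ (toℤ₈ -[1+ n ])

toℤ₈-suc : ∀ x → toℤ₈ (x + + 1) ≡ suc₈ (toℤ₈ x)
toℤ₈-suc (+ n)          = cong (toℤ₈ ∘ +_) (ℕP.+-comm n 1)
toℤ₈-suc -[1+ zero ]    = refl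
toℤ₈-suc -[1+ suc n ]   = sym (suc₈-pred₈ _)

toℤ₈-pred : ∀ x → toℤ₈ (x - + 1) ≡ pred₈ (toℤ₈ x)
toℤ₈-pred x = begin
  toℤ₈ (x - + 1)                   ≡⟨ pred₈-suc₈ _ ⟨
  pred₈ (suc₈ (toℤ₈ (x - + 1)))    ≡⟨ cong pred₈ (toℤ₈-suc (x - + 1)) ⟨
  pred₈ (toℤ₈ (x - + 1 + + 1))     ≡⟨ cong (pred₈ ∘ toℤ₈) (cancel x) ⟩
  pred₈ (toℤ₈ x)                   ∎
  where
  open ≡-Reasoning
  cancel : ∀ x → x - + 1 + + 1 ≡ x
  cancel = solve-∀

toℤ₈-plus4 : ∀ x → toℤ₈ (x + + 4) ≡ add4 (toℤ₈ x)
toℤ₈-plus4 x = begin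
  toℤ₈ (x + + 4)                            ≡⟨ cong toℤ₈ (unfold x) ⟩
  toℤ₈ (x + + 1 + + 1 + + 1 + + 1)          ≡⟨ toℤ₈-suc (x + + 1 + + 1 + + 1) ⟩
  suc₈ (toℤ₈ (x + + 1 + + 1 + + 1))         ≡⟨ cong suc₈ (toℤ₈-suc (x + + 1 + + 1)) ⟩
  suc₈ (suc₈ (toℤ₈ (x + + 1 + + 1)))        ≡⟨ cong (suc₈ ∘ suc₈) (toℤ₈-suc (x + + 1)) ⟩
  suc₈ (suc₈ (suc₈ (toℤ₈ (x + + 1))))       ≡⟨ cong (suc₈ ∘ suc₈ ∘ suc₈) (toℤ₈-suc x) ⟩
  add4 (toℤ₈ x)                             ∎
  where
  open ≡-Reasoning
  unfold : ∀ x → x + + 4 ≡ x + + 1 + + 1 + + 1 + + 1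
  unfold = solve-∀

toℤ₈-minus4 : ∀ x → toℤ₈ (x - + 4) ≡ add4 (toℤ₈ x)
toℤ₈-minus4 x = begin
  toℤ₈ (x - + 4)                            ≡⟨ cong toℤ₈ (unfold x) ⟩
  toℤ₈ (x - + 1 - + 1 - + 1 - + 1)          ≡⟨ toℤ₈-pred (x - + 1 - + 1 - + 1) ⟩
  pred₈ (toℤ₈ (x - + 1 - + 1 - + 1))        ≡⟨ cong pred₈ (toℤ₈-pred (x - + 1 - + 1)) ⟩
  pred₈ (pred₈ (toℤ₈ (x - + 1 - + 1)))      ≡⟨ cong (pred₈ ∘ pred₈) (toℤ₈-pred (x - + 1)) ⟩
  pred₈ (pred₈ (pred₈ (toℤ₈ (x - + 1))))    ≡⟨ cong (pred₈ ∘ pred₈ ∘ pred₈) (toℤ₈-pred x) ⟩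
  pred₈ (pred₈ (pred₈ (pred₈ (toℤ₈ x))))    ≡⟨ pred₈⁴≡add4 _ ⟩
  add4 (toℤ₈ x)                             ∎
  where
  open ≡-Reasoning
  unfold : ∀ x → x - + 4 ≡ x - + 1 - + 1 - + 1 - + 1
  unfold = solve-∀

toℤ₈-+ℕ : ∀ x k → toℤ₈ (x + + k) ≡ toℤ₈ x +₈ k
toℤ₈-+ℕ x zero    = cong toℤ₈ (ℤP.+-identityʳ x)
toℤ₈-+ℕ x (suc k) = begin
  toℤ₈ (x + + suc k)           ≡⟨ cong toℤ₈ (unfold x (+ k)) ⟩
  toℤ₈ (x + + k + + 1)         ≡⟨ toℤ₈-suc (x + + k) ⟩
  suc₈ (toℤ₈ (x + + k))        ≡⟨ cong suc₈ (toℤ₈-+ℕ x k) ⟩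
  suc₈ (toℤ₈ x +₈ k)           ∎
  where
  open ≡-Reasoning
  unfold : ∀ x k → x + (+ 1 + k) ≡ x + k + + 1
  unfold = solve-∀

-- i + 4 j mod 8, on which twist acts as ± 4, that is, as the same map add4.
residue : Vertex → ℤ₈
residue (i , j) = toℤ₈ (i + + 4 ℤ.* j)

shift₈ : Dir → ℤ₈ → ℤ₈
shift₈ east  = suc₈
shift₈ west  = pred₈
shift₈ twist = add4

residue-step : ∀ d v → residue (step d v) ≡ shift₈ d (residue v)
residue-step east (i , j) = trans (cong toℤ₈ (shuffle i j)) (toℤ₈-suc (i + + 4 ℤ.* j))
  where
  shuffle : ∀ i j → i + + 1 + + 4 ℤ.* j ≡ i + + 4 ℤ.* j + + 1
  shuffle = solve-∀
residue-step west (i , j) = trans (cong toℤ₈ (shuffle i j)) (toℤ₈-pred (i + + 4 ℤ.* j))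
  where
  shuffle : ∀ i j → i - + 1 + + 4 ℤ.* j ≡ i + + 4 ℤ.* j - + 1
  shuffle = solve-∀
residue-step twist (i , j) with neg1pow≡±1 (i + j + + 1)
... | inj₁ o≡1  = trans (cong (λ o → toℤ₈ (i + + 4 ℤ.* (j - o))) o≡1)
                        (trans (cong toℤ₈ (down i j)) (toℤ₈-minus4 (i + + 4 ℤ.* j)))
  where
  down : ∀ i j → i + + 4 ℤ.* (j - + 1) ≡ i + + 4 ℤ.* j - + 4
  down = solve-∀
... | inj₂ o≡-1 = trans (cong (λ o → toℤ₈ (i + + 4 ℤ.* (j - o))) o≡-1)
                        (trans (cong toℤ₈ (up i j)) (toℤ₈-plus4 (i + + 4 ℤ.* j)))
  where
  up : ∀ i j → i + + 4 ℤ.* (j + + 1) ≡ i + + 4 ℤ.* j + + 4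
  up = solve-∀

residue-+ᵥ : ∀ v k → residue (v +ᵥ (+ k , + 0)) ≡ residue v +₈ k
residue-+ᵥ (i , j) k = trans (cong toℤ₈ (shuffle i j (+ k))) (toℤ₈-+ℕ (i + + 4 ℤ.* j) k)
  where
  shuffle : ∀ i j k → i + k + + 4 ℤ.* (j + + 0) ≡ i + + 4 ℤ.* j + k
  shuffle = solve-∀

inC₀ : ℤ₈ → Bool
inC₀ r0 = true
inC₀ r1 = true
inC₀ r2 = true
inC₀ _  = false

C₀ : Code
C₀ v = inC₀ (residue v)

C₀-nonempty : Nonempty C₀
C₀-nonempty = (+ 0 , + 0) , refl

C₀-covering : Covering C₀
C₀-covering u = cover (residue u) refl
  where
  by-self : C₀ u ≡ true → ∃ (InI C₀ u)
  by-self u∈C₀ = u , inj₁ refl , u∈C₀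
  by-step : ∀ d → inC₀ (shift₈ d (residue u)) ≡ true → ∃ (InI C₀ u)
  by-step d w∈C₀ = step d u , inj₂ (adj-step d u) , trans (cong inC₀ (residue-step d u)) w∈C₀
  cover : ∀ r → residue u ≡ r → ∃ (InI C₀ u)
  cover r0 eq = by-self (cong inC₀ eq)
  cover r1 eq = by-self (cong inC₀ eq)
  cover r2 eq = by-self (cong inC₀ eq)
  cover r3 eq = by-step west (cong (inC₀ ∘ pred₈) eq)
  cover r4 eq = by-step twist (cong (inC₀ ∘ add4) eq)
  cover r5 eq = by-step twist (cong (inC₀ ∘ add4) eq)
  cover r6 eq = by-step twist (cong (inC₀ ∘ add4) eq)
  cover r7 eq = by-step east (cong (inC₀ ∘ suc₈) eq)

symDiffHasCode₈ : Dir → ℤ₈ → Bool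
symDiffHasCode₈ d r =
  inC₀ (shift₈ (next d) r) ∨ inC₀ (shift₈ (next (next d)) r) ∨
  inC₀ (shift₈ (next d′) r′) ∨ inC₀ (shift₈ (next (next d′)) r′)
  where
  r′ = shift₈ d r
  d′ = opposite d

symDiffHasCode-C₀ : ∀ d u → symDiffHasCode C₀ d u ≡ symDiffHasCode₈ d (residue u)
symDiffHasCode-C₀ d u
  rewrite residue-step (next d) u | residue-step (next (next d)) u
        | residue-step (next (opposite d)) (step d u) | residue-step (next (next (opposite d))) (step d u)
        | residue-step d u = refl

symDiffHasCode₈-holds : ∀ r → allDir (λ d → symDiffHasCode₈ d r) ≡ true
symDiffHasCode₈-holds r0 = refl
symDiffHasCode₈-holds r1 = refl
symDiffHasCode₈-holds r2 = refl
symDiffHasCode₈-holds r3 = refl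
symDiffHasCode₈-holds r4 = refl
symDiffHasCode₈-holds r5 = refl
symDiffHasCode₈-holds r6 = refl
symDiffHasCode₈-holds r7 = refl

C₀-localId : LocalIdCode C₀
C₀-localId = symDiffHasCode⇒localId C₀-nonempty C₀-covering λ d u →
  trans (symDiffHasCode-C₀ d u) (allDir-true (λ e → symDiffHasCode₈ e (residue u)) (symDiffHasCode₈-holds (residue u)) d)

window₈ : ∀ r → ∑[ k < 8 ] bit (inC₀ (r +₈ k)) ≡ 3
window₈ r0 = refl
window₈ r1 = refl
window₈ r2 = refl
window₈ r3 = refl
window₈ r4 = refl
window₈ r5 = refl
window₈ r6 = refl
window₈ r7 = refl

C₀-upper-bound : ∀ n → 8 ℕ.* countIn C₀ n ≤ 3 ℕ.* sizeQ (7 ℕ.+ n)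
C₀-upper-bound n = begin
  8 ℕ.* boxSum χ n                                   ≡⟨ trans (∑-const 8 (boxSum χ n)) (ℕP.*-comm (boxSum χ n) 8) ⟨
  ∑[ k < 8 ] boxSum χ n                              ≤⟨ ∑-mono 8 (λ k k<8 → shifted k (ℕP.≤-pred k<8)) ⟩
  ∑[ k < 8 ] boxSum (λ v → χ (v +ᵥ (+ k , + 0))) n′  ≡⟨ boxSum-∑ n′ 8 (λ k v → χ (v +ᵥ (+ k , + 0))) ⟨
  boxSum (λ v → ∑[ k < 8 ] χ (v +ᵥ (+ k , + 0))) n′  ≡⟨ boxSum-cong n′ window ⟩
  boxSum (λ _ → 3) n′                                ≡⟨ boxSum-const n′ 3 ⟩
  3 ℕ.* sizeQ n′                                     ∎
  where
  open ℕP.≤-Reasoning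
  n′ = 7 ℕ.+ n
  χ : Vertex → ℕ
  χ v = bit (C₀ v)
  window : ∀ v → ∑[ k < 8 ] χ (v +ᵥ (+ k , + 0)) ≡ 3
  window v = trans (∑-cong 8 (λ k → cong (bit ∘ inC₀) (residue-+ᵥ v k))) (window₈ (residue v))
  shifted : ∀ k → k ≤ 7 → boxSum χ n ≤ boxSum (λ v → χ (v +ᵥ (+ k , + 0))) n′
  shifted k k≤7 = subst (_≤ boxSum (λ v → χ (v +ᵥ (+ k , + 0))) n′)
    (boxSum-cong n {g = χ} (λ (i , j) → cong χ (cong₂ _,_ (back i (+ k)) (back′ j))))
    (boxSum-translate (λ v → χ (v +ᵥ (+ k , + 0))) n 7 (- + k , + 0)
                      (subst (_≤ 7) (sym (ℤP.∣-i∣≡∣i∣ (+ k))) k≤7) z≤n)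
    where
    back : ∀ i k → i + - k + k ≡ i
    back = solve-∀
    back′ : ∀ j → j + + 0 + + 0 ≡ j
    back′ = solve-∀

-- From box counts to upper densities

private
  minus-≤ : ∀ {a b c} → a ≤ b ℕ.+ c → + a - + c ℤ.≤ + b
  minus-≤ {a} {b} {c} a≤b+c =
    subst (+ a - + c ℤ.≤_) (trans (cong (_- + c) (ℤP.pos-+ b c)) (cancel (+ b) (+ c)))
          (ℤP.+-monoˡ-≤ (- + c) (ℤ.+≤+ a≤b+c))
    where
    cancel : ∀ b c → b + c - c ≡ b
    cancel = solve-∀

  3/8-ε≤ : ∀ ε → ℚ.Positive ε → ∀ k S →
           3 ℕ.* ℚ.↧ₙ ε ℕ.* suc S ≤ k ℕ.* (8 ℕ.* ℚ.↧ₙ ε) ℕ.+ 8 ℕ.* ∣ ℚ.↥ ε ∣ ℕ.* suc S →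
           (+ 3 / 8) ℚ.- ε ℚ.≤ (+ k) / suc S
  3/8-ε≤ ε@(mkℚ +[1+ p ] d _) _ k S h = QP.toℚᵘ-cancel-≤
    (UP.≤-respʳ-≃ (UP.≃-sym (QP.toℚᵘ-fromℚᵘ (mkℚᵘ (+ k) S)))
      (UP.≤-respˡ-≃ (UP.≃-sym (QP.toℚᵘ-homo-+ (+ 3 / 8) (ℚ.- ε)))
        (ℚᵘ.*≤* (subst₂ ℤ._≤_ (sym lhs) (ℤP.pos-* k (8 ℕ.* suc d)) (minus-≤ h)))))
    where
    lhs : (+ 3 ℤ.* + suc d + -[1+ p ] ℤ.* + 8) ℤ.* + suc S ≡ + (3 ℕ.* suc d ℕ.* suc S) - + (8 ℕ.* suc p ℕ.* suc S)
    lhs rewrite sym (ℤP.pos-* (3 ℕ.* suc d) (suc S)) | sym (ℤP.pos-* 3 (suc d))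
              | sym (ℤP.pos-* (8 ℕ.* suc p) (suc S)) | sym (ℤP.pos-* 8 (suc p)) = expand (+ suc d) (+ suc S) (+ suc p)
      where
      expand : ∀ D S P → (+ 3 ℤ.* D + (- P) ℤ.* + 8) ℤ.* S ≡ + 3 ℤ.* D ℤ.* S - + 8 ℤ.* P ℤ.* S
      expand = solve-∀

  ≤3/8+ε : ∀ ε → ℚ.Positive ε → ∀ k S →
           k ℕ.* (8 ℕ.* ℚ.↧ₙ ε) ≤ (3 ℕ.* ℚ.↧ₙ ε ℕ.+ ∣ ℚ.↥ ε ∣ ℕ.* 8) ℕ.* suc S →
           (+ k) / suc S ℚ.≤ (+ 3 / 8) ℚ.+ ε
  ≤3/8+ε ε@(mkℚ +[1+ p ] d _) _ k S h = QP.toℚᵘ-cancel-≤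
    (UP.≤-respˡ-≃ (UP.≃-sym (QP.toℚᵘ-fromℚᵘ (mkℚᵘ (+ k) S)))
      (UP.≤-respʳ-≃ (UP.≃-sym (QP.toℚᵘ-homo-+ (+ 3 / 8) ε))
        (ℚᵘ.*≤* (subst₂ ℤ._≤_ (ℤP.pos-* k (8 ℕ.* suc d)) rhs (ℤ.+≤+ h)))))
    where
    rhs : + ((3 ℕ.* suc d ℕ.+ suc p ℕ.* 8) ℕ.* suc S) ≡ (+ 3 ℤ.* + suc d + +[1+ p ] ℤ.* + 8) ℤ.* + suc S
    rhs = begin
      + ((3 ℕ.* suc d ℕ.+ suc p ℕ.* 8) ℕ.* suc S)     ≡⟨ ℤP.pos-* (3 ℕ.* suc d ℕ.+ suc p ℕ.* 8) (suc S) ⟩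
      + (3 ℕ.* suc d ℕ.+ suc p ℕ.* 8) ℤ.* + suc S      ≡⟨ cong (ℤ._* + suc S) (ℤP.pos-+ (3 ℕ.* suc d) (suc p ℕ.* 8)) ⟩
      (+ (3 ℕ.* suc d) + + (suc p ℕ.* 8)) ℤ.* + suc S
        ≡⟨ cong (ℤ._* + suc S) (cong₂ _+_ (ℤP.pos-* 3 (suc d)) (ℤP.pos-* (suc p) 8)) ⟩
      (+ 3 ℤ.* + suc d + +[1+ p ] ℤ.* + 8) ℤ.* + suc S ∎
      where open ≡-Reasoning

  growth-below : ∀ m k p D → 12 ℕ.* sizeQ m ≤ 32 ℕ.* k → D ≤ suc m →
                 3 ℕ.* D ℕ.* sizeQ (suc m) ≤ k ℕ.* (8 ℕ.* D) ℕ.+ 8 ℕ.* suc p ℕ.* sizeQ (suc m)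
  growth-below m k p D count D≤M = begin
    3 ℕ.* D ℕ.* S′                             ≡⟨ cong (3 ℕ.* D ℕ.*_) (grow m) ⟩
    3 ℕ.* D ℕ.* (S ℕ.+ 8 ℕ.* M)                ≡⟨ expand D S M ⟩
    D ℕ.* (3 ℕ.* S) ℕ.+ 24 ℕ.* (D ℕ.* M)
      ≤⟨ ℕP.+-mono-≤ (ℕP.*-monoʳ-≤ D 3S≤8k) (ℕP.*-monoʳ-≤ 24 (ℕP.*-monoˡ-≤ M D≤M)) ⟩
    D ℕ.* (8 ℕ.* k) ℕ.+ 24 ℕ.* (M ℕ.* M)
      ≤⟨ ℕP.+-monoʳ-≤ (D ℕ.* (8 ℕ.* k)) (subst (24 ℕ.* (M ℕ.* M) ≤_) (sym (square M)) (ℕP.m≤m+n _ _)) ⟩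
    D ℕ.* (8 ℕ.* k) ℕ.+ 8 ℕ.* S′
      ≤⟨ ℕP.+-monoʳ-≤ (D ℕ.* (8 ℕ.* k)) (subst (8 ℕ.* S′ ≤_) (reorder p S′) (ℕP.m≤m*n (8 ℕ.* S′) (suc p))) ⟩
    D ℕ.* (8 ℕ.* k) ℕ.+ 8 ℕ.* suc p ℕ.* S′     ≡⟨ cong (ℕ._+ 8 ℕ.* suc p ℕ.* S′) (swap D k) ⟩
    k ℕ.* (8 ℕ.* D) ℕ.+ 8 ℕ.* suc p ℕ.* S′     ∎
    where
    open ℕP.≤-Reasoning
    S = sizeQ m
    M = suc m
    S′ = sizeQ M
    3S≤8k : 3 ℕ.* S ≤ 8 ℕ.* k
    3S≤8k = ℕP.*-cancelˡ-≤ 4 (subst₂ _≤_ (ℕP.*-assoc 4 3 S) (ℕP.*-assoc 4 8 k) count)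
    grow : ∀ m → suc (4 ℕ.* suc m ℕ.* suc m ℕ.+ 4 ℕ.* suc m) ≡ suc (4 ℕ.* m ℕ.* m ℕ.+ 4 ℕ.* m) ℕ.+ 8 ℕ.* suc m
    grow = ℕSolver.solve-∀
    expand : ∀ D S M → 3 ℕ.* D ℕ.* (S ℕ.+ 8 ℕ.* M) ≡ D ℕ.* (3 ℕ.* S) ℕ.+ 24 ℕ.* (D ℕ.* M)
    expand = ℕSolver.solve-∀
    square : ∀ M → 8 ℕ.* suc (4 ℕ.* M ℕ.* M ℕ.+ 4 ℕ.* M) ≡ 24 ℕ.* (M ℕ.* M) ℕ.+ (8 ℕ.* (M ℕ.* M) ℕ.+ 32 ℕ.* M ℕ.+ 8)
    square = ℕSolver.solve-∀
    reorder : ∀ p S → 8 ℕ.* S ℕ.* suc p ≡ 8 ℕ.* suc p ℕ.* S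
    reorder = ℕSolver.solve-∀
    swap : ∀ D k → D ℕ.* (8 ℕ.* k) ≡ k ℕ.* (8 ℕ.* D)
    swap = ℕSolver.solve-∀

  growth-above : ∀ n k p D → 8 ℕ.* k ≤ 3 ℕ.* sizeQ (7 ℕ.+ n) → 28 ℕ.* D ≤ n →
                 k ℕ.* (8 ℕ.* D) ≤ (3 ℕ.* D ℕ.+ suc p ℕ.* 8) ℕ.* sizeQ n
  growth-above n k p D count 28D≤n = begin
    k ℕ.* (8 ℕ.* D)                                           ≡⟨ swap k D ⟩
    D ℕ.* (8 ℕ.* k)                                           ≤⟨ ℕP.*-monoʳ-≤ D count ⟩
    D ℕ.* (3 ℕ.* sizeQ (7 ℕ.+ n))                             ≡⟨ expand n D ⟩
    3 ℕ.* D ℕ.* S ℕ.+ (6 ℕ.* (28 ℕ.* D) ℕ.* n ℕ.+ 24 ℕ.* (28 ℕ.* D))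
      ≤⟨ ℕP.+-monoʳ-≤ (3 ℕ.* D ℕ.* S)
           (ℕP.+-mono-≤ (ℕP.*-monoˡ-≤ n (ℕP.*-monoʳ-≤ 6 28D≤n)) (ℕP.*-monoʳ-≤ 24 28D≤n)) ⟩
    3 ℕ.* D ℕ.* S ℕ.+ (6 ℕ.* n ℕ.* n ℕ.+ 24 ℕ.* n)
      ≤⟨ ℕP.+-monoʳ-≤ (3 ℕ.* D ℕ.* S) (subst (6 ℕ.* n ℕ.* n ℕ.+ 24 ℕ.* n ≤_) (sym (square n)) (ℕP.m≤m+n _ _)) ⟩
    3 ℕ.* D ℕ.* S ℕ.+ 8 ℕ.* S
      ≤⟨ ℕP.+-monoʳ-≤ (3 ℕ.* D ℕ.* S) (subst (8 ℕ.* S ≤_) (reorder p S) (ℕP.m≤m*n (8 ℕ.* S) (suc p))) ⟩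
    3 ℕ.* D ℕ.* S ℕ.+ suc p ℕ.* 8 ℕ.* S                       ≡⟨ ℕP.*-distribʳ-+ S (3 ℕ.* D) (suc p ℕ.* 8) ⟨
    (3 ℕ.* D ℕ.+ suc p ℕ.* 8) ℕ.* S                           ∎
    where
    open ℕP.≤-Reasoning
    S = sizeQ n
    swap : ∀ k D → k ℕ.* (8 ℕ.* D) ≡ D ℕ.* (8 ℕ.* k)
    swap = ℕSolver.solve-∀
    expand : ∀ n D → D ℕ.* (3 ℕ.* suc (4 ℕ.* (7 ℕ.+ n) ℕ.* (7 ℕ.+ n) ℕ.+ 4 ℕ.* (7 ℕ.+ n))) ≡
                     3 ℕ.* D ℕ.* suc (4 ℕ.* n ℕ.* n ℕ.+ 4 ℕ.* n) ℕ.+ (6 ℕ.* (28 ℕ.* D) ℕ.* n ℕ.+ 24 ℕ.* (28 ℕ.* D))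
    expand = ℕSolver.solve-∀
    square : ∀ n → 8 ℕ.* suc (4 ℕ.* n ℕ.* n ℕ.+ 4 ℕ.* n) ≡ 6 ℕ.* n ℕ.* n ℕ.+ 24 ℕ.* n ℕ.+ (26 ℕ.* n ℕ.* n ℕ.+ 8 ℕ.* n ℕ.+ 8)
    square = ℕSolver.solve-∀
    reorder : ∀ p S → 8 ℕ.* S ℕ.* suc p ≡ suc p ℕ.* 8 ℕ.* S
    reorder = ℕSolver.solve-∀

limsupGE-3/8 : ∀ C → (∀ m → 12 ℕ.* sizeQ m ≤ 32 ℕ.* countIn C (suc m)) → LimsupGE (ratio C) (+ 3 / 8)
limsupGE-3/8 C lower ε@(mkℚ +[1+ p ] d _) pos N =
  suc (N ℕ.+ d) , ℕP.≤-trans (ℕP.m≤m+n N d) (ℕP.n≤1+n _) ,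
  3/8-ε≤ ε pos k _ (growth-below (N ℕ.+ d) k p (suc d) (lower (N ℕ.+ d)) (s≤s (ℕP.m≤n+m d N)))
  where
  k = countIn C (suc (N ℕ.+ d))

limsupLE-3/8 : ∀ C → (∀ n → 8 ℕ.* countIn C n ≤ 3 ℕ.* sizeQ (7 ℕ.+ n)) → LimsupLE (ratio C) (+ 3 / 8)
limsupLE-3/8 C upper ε@(mkℚ +[1+ p ] d _) pos =
  28 ℕ.* suc d , λ n 28D≤n → ≤3/8+ε ε pos (countIn C n) _ (growth-above n (countIn C n) p (suc d) (upper n) 28D≤n)

mainTheorem16 : (Σ Code λ C → LocalIdCode C × HasDensity C (+ 3 / 8))
                × (∀ C → LocalIdCode C → DensityAtLeast C (+ 3 / 8))
mainTheorem16 =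
  (C₀ , C₀-localId , limsupLE-3/8 C₀ C₀-upper-bound , limsupGE-3/8 C₀ (lower-bound C₀ C₀-localId)) ,
  λ C L → limsupGE-3/8 C (lower-bound C L)
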